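{- Let $n\ge2$ and $f\in\mathfrak{T}(2,n,*)$ with $P(f)$ of positive area. Then $$ S(f,\mathfrak{T}(2,n,*))=(\Delta P(f)\cap M_0(f))\cup\textup{Vert}(P(f)). $$
   Context: $E_n^2=\{0,\dots,n-1\}^2$, $M_\nu(f)=\{x\in E_n^2: f(x)=\nu\}$. $\mathfrak{T}(2,n,*)$ is the class of functions $f:E_n^2\to\{0,1\}$ for which, for some $k$, there are reals $a_{ij}$ with $M_1(f)=\{x\in E_n^2: a_{i1}x_1+a_{i2}x_2\le a_{i0},\ i=1,\dots,k\}$. For $f\in\mathcal{C}$, $x$ is essential for $f$ with respect to $\mathcal{C}$ if some $g\in\mathcal{C}$ differs from $f$ exactly at $x$; $S(f,\mathcal{C})$ is the set of essential points. $P(f)=\textup{Conv}(M_1(f))$, $\textup{Vert}(P)$ is the vertex set. When $P(f)$ has positive area, each edge lies on a line $a_1x_1+a_2x_2=a_0$ with $a_1,a_2$ coprime integers, oriented so that $a_1x_1+a_2x_2\le a_0$ on $P(f)$; $P'(f)$ is the set of points of $\mathbb{R}^2$ satisfying $a_1x_1+a_2x_2\le a_0+1$ for all edges of $P(f)$, and $\Delta P(f)=P'(f)\setminus P(f)$.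
   Formalization: The coefficients $a_{ij}$ in the definition of the class $\mathfrak{T}(2,n,*)$ are rational instead of real. -}

module Defs where

open import Data.Nat using (ℕ; zero; suc)
open import Data.Nat.Coprimality using (Coprime)
open import Data.Fin using (Fin; toℕ)
open import Data.Bool using (Bool; true; false)
open import Data.Product using (Σ; ∃; _×_; _,_; proj₁; proj₂)
open import Data.Sum using (_⊎_)
open import Relation.Nullary using (¬_)
open import Relation.Binary.PropositionalEquality using (_≡_; _≢_)
open import Function.Bundles using (_⇔_)
open import Data.Integer as ℤ using (ℤ; +_; ∣_∣)
open import Data.Rational as ℚ using (ℚ; 0ℚ; 1ℚ; _/_)

Pt : ℕ → Set
Pt n = Fin n × Fin n

BoolFun : ℕ → Set
BoolFun n = Pt n → Bool

M₁ : ∀ {n} → BoolFun n → Pt n → Set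
M₁ f x = f x ≡ true

M₀ : ∀ {n} → BoolFun n → Pt n → Set
M₀ f x = f x ≡ false

zc : ∀ {n} → Fin n → ℤ
zc i = + toℕ i

qc : ∀ {n} → Fin n → ℚ
qc i = (+ toℕ i) / 1

-- the class 𝔗(2,n,*) (coefficients taken rational)
InT : (n : ℕ) → BoolFun n → Set
InT n f = Σ ℕ λ k → Σ (Fin k → ℚ) λ a₁ → Σ (Fin k → ℚ) λ a₂ → Σ (Fin k → ℚ) λ a₀ →
  (x : Pt n) → (f x ≡ true) ⇔
    ((i : Fin k) → (a₁ i ℚ.* qc (proj₁ x) ℚ.+ a₂ i ℚ.* qc (proj₂ x)) ℚ.≤ a₀ i)

Essential : (n : ℕ) → BoolFun n → Pt n → Set
Essential n f x = Σ (BoolFun n) λ g → InT n g × (g x ≢ f x) × ((y : Pt n) → y ≢ x → g y ≡ f y)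

Σℚ : (m : ℕ) → (Fin m → ℚ) → ℚ
Σℚ zero h = 0ℚ
Σℚ (suc m) h = h Fin.zero ℚ.+ Σℚ m (λ i → h (Fin.suc i))
  where import Data.Fin as Fin

ΣPt : (n : ℕ) → (Pt n → ℚ) → ℚ
ΣPt n h = Σℚ n λ i → Σℚ n λ j → h (i , j)

InConv : (n : ℕ) → (Pt n → Set) → ℚ → ℚ → Set
InConv n S x₁ x₂ = Σ (Pt n → ℚ) λ w →
  ((p : Pt n) → 0ℚ ℚ.≤ w p) ×
  ((p : Pt n) → w p ≢ 0ℚ → S p) ×
  (ΣPt n w ≡ 1ℚ) ×
  (ΣPt n (λ p → w p ℚ.* qc (proj₁ p)) ≡ x₁) ×
  (ΣPt n (λ p → w p ℚ.* qc (proj₂ p)) ≡ x₂)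

InP : (n : ℕ) → BoolFun n → Pt n → Set
InP n f x = InConv n (M₁ f) (qc (proj₁ x)) (qc (proj₂ x))

IsVertex : (n : ℕ) → BoolFun n → Pt n → Set
IsVertex n f x = M₁ f x × ¬ InConv n (λ p → M₁ f p × p ≢ x) (qc (proj₁ x)) (qc (proj₂ x))

PositiveArea : (n : ℕ) → BoolFun n → Set
PositiveArea n f = Σ (Pt n) λ p → Σ (Pt n) λ q → Σ (Pt n) λ r →
  M₁ f p × M₁ f q × M₁ f r ×
  ((zc (proj₁ q) ℤ.- zc (proj₁ p)) ℤ.* (zc (proj₂ r) ℤ.- zc (proj₂ p))
    ≢ (zc (proj₂ q) ℤ.- zc (proj₂ p)) ℤ.* (zc (proj₁ r) ℤ.- zc (proj₁ p)))

lin : ∀ {n} → ℤ → ℤ → Pt n → ℤ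
lin a₁ a₂ x = a₁ ℤ.* zc (proj₁ x) ℤ.+ a₂ ℤ.* zc (proj₂ x)

IsEdgeLine : (n : ℕ) → BoolFun n → ℤ → ℤ → ℤ → Set
IsEdgeLine n f a₁ a₂ a₀ =
  Coprime ∣ a₁ ∣ ∣ a₂ ∣ ×
  ((p : Pt n) → M₁ f p → lin a₁ a₂ p ℤ.≤ a₀) ×
  (Σ (Pt n) λ p → Σ (Pt n) λ q → p ≢ q × M₁ f p × M₁ f q × lin a₁ a₂ p ≡ a₀ × lin a₁ a₂ q ≡ a₀)

InP' : (n : ℕ) → BoolFun n → Pt n → Set
InP' n f x = (a₁ a₂ a₀ : ℤ) → IsEdgeLine n f a₁ a₂ a₀ → lin a₁ a₂ x ℤ.≤ a₀ ℤ.+ + 1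

InΔP : (n : ℕ) → BoolFun n → Pt n → Set
InΔP n f x = InP' n f x × ¬ InP n f x

{-# OPTIONS --safe #-}
module Submission where

open import Defs
open import Data.Nat using (ℕ; _≥_)
open import Data.Product using (_×_)
open import Data.Sum using (_⊎_)
open import Function.Bundles using (_⇔_)

-- 𝔗(2,n,*) consists exactly of the lattice-convex functions, those f for which every grid point of
-- Conv(M₁(f)) lies in M₁(f): half-planes are convex, and conversely every grid point outside a lattice-convex set
-- can be separated from it by an integer line.  So x is essential iff flipping f at x keeps M₁ lattice-convex.
-- Removing x does so iff x is not in the hull of the other points, i.e. x is a vertex.  Adding x ∉ P(f) fails if
-- x lies two or more lattice layers beyond some edge line a·z = a₀: by Bézout the triangle spanned by that edge
-- and x contains a grid point on the layer a·z = a₀ + 1.  If x is at most one layer beyond every edge (x ∈ P′(f)),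
-- every other outside point y is cut off from M₁(f) ∪ {x} by an edge line beyond which y lies, shifted by one
-- layer if necessary, or slightly tilted when x and y both lie on the shifted line.

module Signs where

  open import Data.Integer as ℤ using (ℤ; 0ℤ; _+_; _*_; _-_; -_; _≤_; _<_)
  import Data.Integer.Properties as ℤP
  open import Data.Integer.Tactic.RingSolver using (solve-∀)
  open import Data.Sum as Sum using (inj₁; inj₂)
  open import Relation.Binary.Definitions using (tri<; tri≈; tri>)
  open import Relation.Nullary.Negation using (contradiction)
  open import Relation.Binary.PropositionalEquality

  private variable i j : ℤ

  0≤i*j : 0ℤ ≤ i → 0ℤ ≤ j → 0ℤ ≤ i * j
  0≤i*j {i} 0≤i 0≤j =
    subst (_≤ i * _) (ℤP.*-zeroʳ i) (ℤP.*-monoˡ-≤-nonNeg i {{ℤ.nonNegative 0≤i}} 0≤j)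

  0<i*j : 0ℤ < i → 0ℤ < j → 0ℤ < i * j
  0<i*j {i} 0<i 0<j =
    subst (_< i * _) (ℤP.*-zeroʳ i) (ℤP.*-monoˡ-<-pos i {{ℤ.positive 0<i}} 0<j)

  i≤0∧j≤0⇒0≤i*j : i ≤ 0ℤ → j ≤ 0ℤ → 0ℤ ≤ i * j
  i≤0∧j≤0⇒0≤i*j {i} i≤0 j≤0 =
    subst (_≤ i * _) (ℤP.*-zeroʳ i) (ℤP.*-monoˡ-≤-nonPos i {{ℤ.nonPositive i≤0}} j≤0)

  i<0∧j<0⇒0<i*j : i < 0ℤ → j < 0ℤ → 0ℤ < i * j
  i<0∧j<0⇒0<i*j {i} i<0 j<0 =
    subst (_< i * _) (ℤP.*-zeroʳ i) (ℤP.*-monoˡ-<-neg i {{ℤ.negative i<0}} j<0)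

  0≤i∧j≤0⇒i*j≤0 : 0ℤ ≤ i → j ≤ 0ℤ → i * j ≤ 0ℤ
  0≤i∧j≤0⇒i*j≤0 {i} 0≤i j≤0 =
    subst (i * _ ≤_) (ℤP.*-zeroʳ i) (ℤP.*-monoˡ-≤-nonNeg i {{ℤ.nonNegative 0≤i}} j≤0)

  i≤0∧0<j⇒i*j≤0 : i ≤ 0ℤ → 0ℤ < j → i * j ≤ 0ℤ
  i≤0∧0<j⇒i*j≤0 {i} {j} i≤0 0<j = ℤP.*-monoʳ-≤-nonNeg j {{ℤ.nonNegative (ℤP.<⇒≤ 0<j)}} i≤0

  i<0∧0<j⇒i*j<0 : i < 0ℤ → 0ℤ < j → i * j < 0ℤ
  i<0∧0<j⇒i*j<0 {i} {j} i<0 0<j = ℤP.*-monoʳ-<-pos j {{ℤ.positive 0<j}} i<0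

  0≤i*i : ∀ i → 0ℤ ≤ i * i
  0≤i*i i with ℤP.≤-total 0ℤ i
  ... | inj₁ 0≤i = 0≤i*j 0≤i 0≤i
  ... | inj₂ i≤0 = i≤0∧j≤0⇒0≤i*j i≤0 i≤0

  i≢0⇒0<i*i : i ≢ 0ℤ → 0ℤ < i * i
  i≢0⇒0<i*i {i} i≢0 with ℤP.<-cmp i 0ℤ
  ... | tri< i<0 _ _ = i<0∧j<0⇒0<i*j i<0 i<0
  ... | tri≈ _ i≡0 _ = contradiction i≡0 i≢0
  ... | tri> _ _ 0<i = 0<i*j 0<i 0<i

  0<i∧0≤i*j⇒0≤j : 0ℤ < i → 0ℤ ≤ i * j → 0ℤ ≤ j
  0<i∧0≤i*j⇒0≤j {i} {j} 0<i 0≤ij =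
    ℤP.*-cancelˡ-≤-pos 0ℤ j i {{ℤ.positive 0<i}} (subst (_≤ i * j) (sym (ℤP.*-zeroʳ i)) 0≤ij)

  0<i∧0<i*j⇒0<j : 0ℤ < i → 0ℤ < i * j → 0ℤ < j
  0<i∧0<i*j⇒0<j {i} 0<i 0<ij =
    ℤP.*-cancelˡ-<-nonNeg i {{ℤ.nonNegative (ℤP.<⇒≤ 0<i)}} (subst (_< i * _) (sym (ℤP.*-zeroʳ i)) 0<ij)

  0<i*j∧0<j⇒0<i : 0ℤ < i * j → 0ℤ < j → 0ℤ < i
  0<i*j∧0<j⇒0<i {i} {j} 0<ij 0<j = 0<i∧0<i*j⇒0<j 0<j (subst (0ℤ <_) (ℤP.*-comm i j) 0<ij)

  0<i∧i*j≤0⇒j≤0 : 0ℤ < i → i * j ≤ 0ℤ → j ≤ 0ℤ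
  0<i∧i*j≤0⇒j≤0 {i} {j} 0<i ij≤0 = ℤP.≮⇒≥ λ 0<j → ℤP.<-irrefl refl (ℤP.<-≤-trans (0<i*j 0<i 0<j) ij≤0)

  i*j≤0∧0<j⇒i≤0 : i * j ≤ 0ℤ → 0ℤ < j → i ≤ 0ℤ
  i*j≤0∧0<j⇒i≤0 {i} {j} ij≤0 0<j = ℤP.≮⇒≥ λ 0<i → ℤP.<-irrefl refl (ℤP.<-≤-trans (0<i*j 0<i 0<j) ij≤0)

  i*j<0∧j<0⇒0<i : i * j < 0ℤ → j < 0ℤ → 0ℤ < i
  i*j<0∧j<0⇒0<i {i} {j} ij<0 j<0 =
    ℤP.≰⇒> λ i≤0 → ℤP.<-irrefl refl (ℤP.<-≤-trans ij<0 (i≤0∧j≤0⇒0≤i*j i≤0 (ℤP.<⇒≤ j<0)))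

  0<i∧i*j≡0⇒j≡0 : 0ℤ < i → i * j ≡ 0ℤ → j ≡ 0ℤ
  0<i∧i*j≡0⇒j≡0 {i} 0<i ij≡0 =
    Sum.[ (λ i≡0 → contradiction (sym i≡0) (ℤP.<⇒≢ 0<i)) , (λ j≡0 → j≡0) ]′ (ℤP.i*j≡0⇒i≡0∨j≡0 i ij≡0)

  i*j≡0∧j≢0⇒i≡0 : i * j ≡ 0ℤ → j ≢ 0ℤ → i ≡ 0ℤ
  i*j≡0∧j≢0⇒i≡0 {i} ij≡0 j≢0 = Sum.[ (λ i≡0 → i≡0) , (λ j≡0 → contradiction j≡0 j≢0) ]′ (ℤP.i*j≡0⇒i≡0∨j≡0 i ij≡0)

  i<j⇒0<j-i : i < j → 0ℤ < j - i
  i<j⇒0<j-i {i} {j} i<j = subst (_< j - i) (ℤP.+-inverseʳ i) (ℤP.+-monoˡ-< (- i) i<j)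

  i<j⇒i-j<0 : i < j → i - j < 0ℤ
  i<j⇒i-j<0 {i} {j} i<j = subst (i - j <_) (ℤP.+-inverseʳ j) (ℤP.+-monoˡ-< (- j) i<j)

  0<i-j⇒j<i : 0ℤ < i - j → j < i
  0<i-j⇒j<i {i} {j} 0<i-j = subst₂ _<_ (ℤP.+-identityˡ j) ([i-j]+j≡i i j) (ℤP.+-monoˡ-< j 0<i-j)
    where
    [i-j]+j≡i : ∀ i j → i - j + j ≡ i
    [i-j]+j≡i = solve-∀

  i-j<0⇒i<j : i - j < 0ℤ → i < j
  i-j<0⇒i<j {i} {j} i-j<0 = subst₂ _<_ ([i-j]+j≡i i j) (ℤP.+-identityˡ j) (ℤP.+-monoˡ-< j i-j<0)
    where
    [i-j]+j≡i : ∀ i j → i - j + j ≡ i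
    [i-j]+j≡i = solve-∀

  x+y+z≡0⇒y≤0 : ∀ {x y z} → x + y + z ≡ 0ℤ → 0ℤ ≤ x → 0ℤ ≤ z → y ≤ 0ℤ
  x+y+z≡0⇒y≤0 e 0≤x 0≤z =
    ℤP.≮⇒≥ λ 0<y → ℤP.<-irrefl (sym e) (ℤP.+-mono-<-≤ (ℤP.+-mono-≤-< 0≤x 0<y) 0≤z)

  x+y+z≡0⇒0<z : ∀ {x y z} → x + y + z ≡ 0ℤ → x ≤ 0ℤ → y < 0ℤ → 0ℤ < z
  x+y+z≡0⇒0<z e x≤0 y<0 =
    ℤP.≰⇒> λ z≤0 → ℤP.<-irrefl e (ℤP.+-mono-<-≤ (ℤP.+-mono-≤-< x≤0 y<0) z≤0)

  x+y+z≡0⇒x<0 : ∀ {x y z} → x + y + z ≡ 0ℤ → 0ℤ < y → 0ℤ ≤ z → x < 0ℤ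
  x+y+z≡0⇒x<0 e 0<y 0≤z =
    ℤP.≰⇒> λ 0≤x → ℤP.<-irrefl (sym e) (ℤP.+-mono-<-≤ (ℤP.+-mono-≤-< 0≤x 0<y) 0≤z)

  x+y+z≡0⇒x≡0 : ∀ {x y z} → x + y + z ≡ 0ℤ → x ≤ 0ℤ → y ≤ 0ℤ → z ≤ 0ℤ → x ≡ 0ℤ
  x+y+z≡0⇒x≡0 e x≤0 y≤0 z≤0 =
    ℤP.≤-antisym x≤0 (ℤP.≮⇒≥ λ x<0 → ℤP.<-irrefl e (ℤP.+-mono-<-≤ (ℤP.+-mono-<-≤ x<0 y≤0) z≤0))

  x+y+z≡0⇒z≡0 : ∀ {x y z} → x + y + z ≡ 0ℤ → x ≤ 0ℤ → y ≤ 0ℤ → z ≤ 0ℤ → z ≡ 0ℤ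
  x+y+z≡0⇒z≡0 e x≤0 y≤0 z≤0 =
    ℤP.≤-antisym z≤0 (ℤP.≮⇒≥ λ z<0 → ℤP.<-irrefl e (ℤP.+-mono-≤-< (ℤP.+-mono-≤ x≤0 y≤0) z<0))

  balanced⇒weighted-sum : ∀ {l₁ l₂ l₃ a b c z} →
    l₁ * (a - z) + l₂ * (b - z) + l₃ * (c - z) ≡ 0ℤ →
    l₁ * a + l₂ * b + l₃ * c ≡ (l₁ + l₂ + l₃) * z
  balanced⇒weighted-sum {l₁} {l₂} {l₃} {a} {b} {c} {z} bal = begin
    l₁ * a + l₂ * b + l₃ * c
      ≡⟨ ring l₁ l₂ l₃ a b c z ⟩
    (l₁ + l₂ + l₃) * z + (l₁ * (a - z) + l₂ * (b - z) + l₃ * (c - z))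
      ≡⟨ cong (λ t → (l₁ + l₂ + l₃) * z + t) bal ⟩
    (l₁ + l₂ + l₃) * z + 0ℤ
      ≡⟨ ℤP.+-identityʳ _ ⟩
    (l₁ + l₂ + l₃) * z ∎
    where
    open ≡-Reasoning
    ring : ∀ l₁ l₂ l₃ a b c z → l₁ * a + l₂ * b + l₃ * c
      ≡ (l₁ + l₂ + l₃) * z + (l₁ * (a - z) + l₂ * (b - z) + l₃ * (c - z))
    ring = solve-∀

  module _ {l₁ l₂ l₃ a b c z : ℤ} (0≤l₁ : 0ℤ ≤ l₁) (0≤l₂ : 0ℤ ≤ l₂) (0≤l₃ : 0ℤ ≤ l₃)
           (0<Σl : 0ℤ < l₁ + l₂ + l₃) (bal : l₁ * (a - z) + l₂ * (b - z) + l₃ * (c - z) ≡ 0ℤ) where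

    private
      0≤Σl*d : ∀ {d₁ d₂ d₃} → 0ℤ ≤ d₁ → 0ℤ ≤ d₂ → 0ℤ ≤ d₃ → 0ℤ ≤ l₁ * d₁ + l₂ * d₂ + l₃ * d₃
      0≤Σl*d 0≤d₁ 0≤d₂ 0≤d₃ = ℤP.+-mono-≤ (ℤP.+-mono-≤ (0≤i*j 0≤l₁ 0≤d₁) (0≤i*j 0≤l₂ 0≤d₂)) (0≤i*j 0≤l₃ 0≤d₃)

    balanced-≤ : ∀ {h} → a ≤ h → b ≤ h → c ≤ h → z ≤ h
    balanced-≤ {h} a≤h b≤h c≤h = ℤP.0≤i-j⇒j≤i (0<i∧0≤i*j⇒0≤j 0<Σl (subst (0ℤ ≤_) (sym Σl*[h-z]) Σl*[h-a]≥0))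
      where
      Σl*[h-a]≥0 : 0ℤ ≤ l₁ * (h - a) + l₂ * (h - b) + l₃ * (h - c)
      Σl*[h-a]≥0 = 0≤Σl*d (ℤP.i≤j⇒0≤j-i a≤h) (ℤP.i≤j⇒0≤j-i b≤h) (ℤP.i≤j⇒0≤j-i c≤h)
      ring : ∀ l₁ l₂ l₃ a b c z h → (l₁ + l₂ + l₃) * (h - z)
        ≡ l₁ * (h - a) + l₂ * (h - b) + l₃ * (h - c) + (l₁ * (a - z) + l₂ * (b - z) + l₃ * (c - z))
      ring = solve-∀
      Σl*[h-z] : (l₁ + l₂ + l₃) * (h - z) ≡ l₁ * (h - a) + l₂ * (h - b) + l₃ * (h - c)
      Σl*[h-z] = trans (ring l₁ l₂ l₃ a b c z h) (trans (cong (λ t → l₁ * (h - a) + l₂ * (h - b) + l₃ * (h - c) + t) bal) (ℤP.+-identityʳ _))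

    balanced-≥ : ∀ {h} → h ≤ a → h ≤ b → h ≤ c → h ≤ z
    balanced-≥ {h} h≤a h≤b h≤c = ℤP.0≤i-j⇒j≤i (0<i∧0≤i*j⇒0≤j 0<Σl (subst (0ℤ ≤_) (sym Σl*[z-h]) Σl*[a-h]≥0))
      where
      Σl*[a-h]≥0 : 0ℤ ≤ l₁ * (a - h) + l₂ * (b - h) + l₃ * (c - h)
      Σl*[a-h]≥0 = 0≤Σl*d (ℤP.i≤j⇒0≤j-i h≤a) (ℤP.i≤j⇒0≤j-i h≤b) (ℤP.i≤j⇒0≤j-i h≤c)
      ring : ∀ l₁ l₂ l₃ a b c z h → (l₁ + l₂ + l₃) * (z - h)
        ≡ l₁ * (a - h) + l₂ * (b - h) + l₃ * (c - h) - (l₁ * (a - z) + l₂ * (b - z) + l₃ * (c - z))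
      ring = solve-∀
      Σl*[z-h] : (l₁ + l₂ + l₃) * (z - h) ≡ l₁ * (a - h) + l₂ * (b - h) + l₃ * (c - h)
      Σl*[z-h] = trans (ring l₁ l₂ l₃ a b c z h) (trans (cong (λ t → l₁ * (a - h) + l₂ * (b - h) + l₃ * (c - h) - t) bal) (ℤP.+-identityʳ _))

module Plane where

  open import Data.Integer as ℤ using (ℤ; 0ℤ; 1ℤ; _+_; _*_; _-_; -_; _≤_; _<_)
  import Data.Integer.Properties as ℤP
  open import Data.Integer.Tactic.RingSolver using (solve-∀)
  open import Data.Product using (_×_; _,_; proj₁; proj₂)
  open import Data.Sum as Sum using (_⊎_; inj₁; inj₂)
  open import Relation.Nullary using (yes; no)
  open import Relation.Nullary.Negation using (contradiction)
  open import Relation.Binary.PropositionalEquality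
  open Signs

  ℤ² : Set
  ℤ² = ℤ × ℤ

  0² : ℤ²
  0² = 0ℤ , 0ℤ

  infixl 6 _⊕_ _⊖_
  infixl 7 _⊛_
  infix 8 _·_

  _⊕_ _⊖_ : ℤ² → ℤ² → ℤ²
  (u₁ , u₂) ⊕ (v₁ , v₂) = u₁ + v₁ , u₂ + v₂
  (u₁ , u₂) ⊖ (v₁ , v₂) = u₁ - v₁ , u₂ - v₂

  _⊛_ : ℤ → ℤ² → ℤ²
  k ⊛ (u₁ , u₂) = k * u₁ , k * u₂

  ⊝_ : ℤ² → ℤ²
  ⊝ (u₁ , u₂) = - u₁ , - u₂

  _·_ : ℤ² → ℤ² → ℤ
  (u₁ , u₂) · (v₁ , v₂) = u₁ * v₁ + u₂ * v₂

  perp swap : ℤ² → ℤ²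
  perp (u₁ , u₂) = - u₂ , u₁
  swap (u₁ , u₂) = u₂ , u₁

  -- Defined through perp so that the functional perp d · v is definitionally det d v.
  det : ℤ² → ℤ² → ℤ
  det u v = perp u · v

  ≢0²⇒≢0⊎≢0 : ∀ {d} → d ≢ 0² → proj₁ d ≢ 0ℤ ⊎ proj₂ d ≢ 0ℤ
  ≢0²⇒≢0⊎≢0 {d₁ , d₂} d≢0 with d₁ ℤ.≟ 0ℤ | d₂ ℤ.≟ 0ℤ
  ... | no d₁≢0 | _ = inj₁ d₁≢0
  ... | yes _ | no d₂≢0 = inj₂ d₂≢0
  ... | yes refl | yes refl = contradiction refl d≢0

  d≢0²⇒0<d·d : ∀ {d} → d ≢ 0² → 0ℤ < d · d
  d≢0²⇒0<d·d {d₁ , d₂} d≢0 = Sum.[ (λ d₁≢0 → ℤP.+-mono-<-≤ (i≢0⇒0<i*i d₁≢0) (0≤i*i d₂))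
                                  , (λ d₂≢0 → ℤP.+-mono-≤-< (0≤i*i d₁) (i≢0⇒0<i*i d₂≢0)) ]′ (≢0²⇒≢0⊎≢0 d≢0)

  ·-⊖ : ∀ c u v → c · (u ⊖ v) ≡ c · u - c · v
  ·-⊖ (c₁ , c₂) (u₁ , u₂) (v₁ , v₂) = ring c₁ c₂ u₁ u₂ v₁ v₂
    where
    ring : ∀ c₁ c₂ u₁ u₂ v₁ v₂ → c₁ * (u₁ - v₁) + c₂ * (u₂ - v₂) ≡ c₁ * u₁ + c₂ * u₂ - (c₁ * v₁ + c₂ * v₂)
    ring = solve-∀

  ·-⊖-self : ∀ c v → c · (v ⊖ v) ≡ 0ℤ
  ·-⊖-self (c₁ , c₂) (v₁ , v₂) = ring c₁ c₂ v₁ v₂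
    where
    ring : ∀ c₁ c₂ v₁ v₂ → c₁ * (v₁ - v₁) + c₂ * (v₂ - v₂) ≡ 0ℤ
    ring = solve-∀

  ·-⊛ : ∀ k a v → (k ⊛ a) · v ≡ k * (a · v)
  ·-⊛ k (a₁ , a₂) (v₁ , v₂) = ring k a₁ a₂ v₁ v₂
    where
    ring : ∀ k a₁ a₂ v₁ v₂ → k * a₁ * v₁ + k * a₂ * v₂ ≡ k * (a₁ * v₁ + a₂ * v₂)
    ring = solve-∀

  ·-⊛⊕ : ∀ k a b v → (k ⊛ a ⊕ b) · v ≡ k * (a · v) + b · v
  ·-⊛⊕ k (a₁ , a₂) (b₁ , b₂) (v₁ , v₂) = ring k a₁ a₂ b₁ b₂ v₁ v₂
    where
    ring : ∀ k a₁ a₂ b₁ b₂ v₁ v₂ →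
      (k * a₁ + b₁) * v₁ + (k * a₂ + b₂) * v₂ ≡ k * (a₁ * v₁ + a₂ * v₂) + (b₁ * v₁ + b₂ * v₂)
    ring = solve-∀

  ·-⊝ : ∀ φ v → (⊝ φ) · v ≡ - (φ · v)
  ·-⊝ (φ₁ , φ₂) (v₁ , v₂) = ring φ₁ φ₂ v₁ v₂
    where
    ring : ∀ φ₁ φ₂ v₁ v₂ → - φ₁ * v₁ + - φ₂ * v₂ ≡ - (φ₁ * v₁ + φ₂ * v₂)
    ring = solve-∀

  ·-swap : ∀ φ v → swap φ · swap v ≡ φ · v
  ·-swap (φ₁ , φ₂) (v₁ , v₂) = ℤP.+-comm (φ₂ * v₂) (φ₁ * v₁)

  ·-⊕⊕⊛ : ∀ a p e c D → a · (p ⊕ e ⊕ c ⊛ D) ≡ a · p + a · e + c * (a · D)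
  ·-⊕⊕⊛ (a₁ , a₂) (p₁ , p₂) (e₁ , e₂) c (D₁ , D₂) = ring a₁ a₂ p₁ p₂ e₁ e₂ c D₁ D₂
    where
    ring : ∀ a₁ a₂ p₁ p₂ e₁ e₂ c D₁ D₂ →
      a₁ * (p₁ + e₁ + c * D₁) + a₂ * (p₂ + e₂ + c * D₂) ≡ a₁ * p₁ + a₂ * p₂ + (a₁ * e₁ + a₂ * e₂) + c * (a₁ * D₁ + a₂ * D₂)
    ring = solve-∀

  ·-perp-self : ∀ a → a · perp a ≡ 0ℤ
  ·-perp-self (a₁ , a₂) = ring a₁ a₂
    where
    ring : ∀ a₁ a₂ → a₁ * - a₂ + a₂ * a₁ ≡ 0ℤ
    ring = solve-∀

  ·-⊝-perp-self : ∀ a → a · ⊝ perp a ≡ 0ℤ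
  ·-⊝-perp-self (a₁ , a₂) = ring a₁ a₂
    where
    ring : ∀ a₁ a₂ → a₁ * - - a₂ + a₂ * - a₁ ≡ 0ℤ
    ring = solve-∀

  1⊛ : ∀ v → 1ℤ ⊛ v ≡ v
  1⊛ (v₁ , v₂) = cong₂ _,_ (ℤP.*-identityˡ v₁) (ℤP.*-identityˡ v₂)

  0⊛⊕ : ∀ e v → 0ℤ ⊛ e ⊕ v ≡ v
  0⊛⊕ e (v₁ , v₂) = cong₂ _,_ (ℤP.+-identityˡ v₁) (ℤP.+-identityˡ v₂)

  ⊛-⊝ : ∀ k v → k ⊛ v ≡ (- k) ⊛ (⊝ v)
  ⊛-⊝ k (v₁ , v₂) = cong₂ _,_ (ring k v₁) (ring k v₂)
    where
    ring : ∀ k v → k * v ≡ - k * - v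
    ring = solve-∀

  ⊖≡⇒≡⊕ : ∀ u v {w} → u ⊖ v ≡ w → u ≡ v ⊕ w
  ⊖≡⇒≡⊕ (u₁ , u₂) (v₁ , v₂) refl = cong₂ _,_ (ring u₁ v₁) (ring u₂ v₂)
    where
    ring : ∀ u v → u ≡ v + (u - v)
    ring = solve-∀

  det-antisym : ∀ u v → det v u ≡ - det u v
  det-antisym (u₁ , u₂) (v₁ , v₂) = ring u₁ u₂ v₁ v₂
    where
    ring : ∀ u₁ u₂ v₁ v₂ → - v₂ * u₁ + v₁ * u₂ ≡ - (- u₂ * v₁ + u₁ * v₂)
    ring = solve-∀

  det-self : ∀ u → det u u ≡ 0ℤ
  det-self (u₁ , u₂) = ring u₁ u₂
    where
    ring : ∀ u₁ u₂ → - u₂ * u₁ + u₁ * u₂ ≡ 0ℤ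
    ring = solve-∀

  det-flip-< : ∀ {u v} → 0ℤ < det u v → det v u < 0ℤ
  det-flip-< {u} {v} 0<uv = subst (_< 0ℤ) (sym (det-antisym u v)) (ℤP.neg-mono-< 0<uv)

  det-flip-> : ∀ {u v} → det u v < 0ℤ → 0ℤ < det v u
  det-flip-> {u} {v} uv<0 = subst (0ℤ <_) (sym (det-antisym u v)) (ℤP.neg-mono-< uv<0)

  det-flip-≤ : ∀ {u v} → det u v ≤ 0ℤ → 0ℤ ≤ det v u
  det-flip-≤ {u} {v} uv≤0 = subst (0ℤ ≤_) (sym (det-antisym u v)) (ℤP.neg-mono-≤ uv≤0)

  det-flip-≥ : ∀ {u v} → 0ℤ ≤ det u v → det v u ≤ 0ℤ
  det-flip-≥ {u} {v} 0≤uv = subst (_≤ 0ℤ) (sym (det-antisym u v)) (ℤP.neg-mono-≤ 0≤uv)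

  det-swap : ∀ u v → det (swap u) (swap v) ≡ det v u
  det-swap (u₁ , u₂) (v₁ , v₂) = ring u₁ u₂ v₁ v₂
    where
    ring : ∀ u₁ u₂ v₁ v₂ → - u₁ * v₂ + u₂ * v₁ ≡ - v₂ * u₁ + v₁ * u₂
    ring = solve-∀

  det-⊖ : ∀ a b v → det (a ⊖ b) v ≡ - (det b v + det v a)
  det-⊖ (a₁ , a₂) (b₁ , b₂) (v₁ , v₂) = ring a₁ a₂ b₁ b₂ v₁ v₂
    where
    ring : ∀ a₁ a₂ b₁ b₂ v₁ v₂ →
      - (a₂ - b₂) * v₁ + (a₁ - b₁) * v₂ ≡ - (- b₂ * v₁ + b₁ * v₂ + (- v₂ * a₁ + v₁ * a₂))
    ring = solve-∀

  det≡0⇒cross-equal : ∀ u v → det u v ≡ 0ℤ → proj₁ u * proj₂ v ≡ proj₂ u * proj₁ v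
  det≡0⇒cross-equal (u₁ , u₂) (v₁ , v₂) det≡0 = ℤP.i-j≡0⇒i≡j _ _ (trans (ring u₁ u₂ v₁ v₂) det≡0)
    where
    ring : ∀ u₁ u₂ v₁ v₂ → u₁ * v₂ - u₂ * v₁ ≡ - u₂ * v₁ + u₁ * v₂
    ring = solve-∀

  jacobi : ∀ φ u v w → det v w * (φ · u) + det w u * (φ · v) + det u v * (φ · w) ≡ 0ℤ
  jacobi (φ₁ , φ₂) (u₁ , u₂) (v₁ , v₂) (w₁ , w₂) = ring φ₁ φ₂ u₁ u₂ v₁ v₂ w₁ w₂
    where
    ring : ∀ φ₁ φ₂ u₁ u₂ v₁ v₂ w₁ w₂ →
      (- v₂ * w₁ + v₁ * w₂) * (φ₁ * u₁ + φ₂ * u₂) + (- w₂ * u₁ + w₁ * u₂) * (φ₁ * v₁ + φ₂ * v₂)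
        + (- u₂ * v₁ + u₁ * v₂) * (φ₁ * w₁ + φ₂ * w₂) ≡ 0ℤ
    ring = solve-∀

  jacobi-⊛ : ∀ u v w → det v w ⊛ u ⊕ det w u ⊛ v ⊕ det u v ⊛ w ≡ 0²
  jacobi-⊛ (u₁ , u₂) (v₁ , v₂) (w₁ , w₂) = cong₂ _,_ (ring₁ u₁ u₂ v₁ v₂ w₁ w₂) (ring₂ u₁ u₂ v₁ v₂ w₁ w₂)
    where
    ring₁ : ∀ u₁ u₂ v₁ v₂ w₁ w₂ →
      (- v₂ * w₁ + v₁ * w₂) * u₁ + (- w₂ * u₁ + w₁ * u₂) * v₁ + (- u₂ * v₁ + u₁ * v₂) * w₁ ≡ 0ℤ
    ring₁ = solve-∀
    ring₂ : ∀ u₁ u₂ v₁ v₂ w₁ w₂ →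
      (- v₂ * w₁ + v₁ * w₂) * u₂ + (- w₂ * u₁ + w₁ * u₂) * v₂ + (- u₂ * v₁ + u₁ * v₂) * w₂ ≡ 0ℤ
    ring₂ = solve-∀

  decompose : ∀ a e v → (a · e) ⊛ v ≡ (a · v) ⊛ e ⊕ det e v ⊛ perp a
  decompose (a₁ , a₂) (e₁ , e₂) (v₁ , v₂) =
    cong₂ _,_ (ring₁ a₁ a₂ e₁ e₂ v₁ v₂) (ring₂ a₁ a₂ e₁ e₂ v₁ v₂)
    where
    ring₁ : ∀ a₁ a₂ e₁ e₂ v₁ v₂ →
      (a₁ * e₁ + a₂ * e₂) * v₁ ≡ (a₁ * v₁ + a₂ * v₂) * e₁ + (- e₂ * v₁ + e₁ * v₂) * - a₂
    ring₁ = solve-∀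
    ring₂ : ∀ a₁ a₂ e₁ e₂ v₁ v₂ →
      (a₁ * e₁ + a₂ * e₂) * v₂ ≡ (a₁ * v₁ + a₂ * v₂) * e₂ + (- e₂ * v₁ + e₁ * v₂) * a₁
    ring₂ = solve-∀

  collinear-⊛ : ∀ d u v → det u v ⊛ d ≡ det d v ⊛ u ⊖ det d u ⊛ v
  collinear-⊛ (d₁ , d₂) (u₁ , u₂) (v₁ , v₂) =
    cong₂ _,_ (ring₁ d₁ d₂ u₁ u₂ v₁ v₂) (ring₂ d₁ d₂ u₁ u₂ v₁ v₂)
    where
    ring₁ : ∀ d₁ d₂ u₁ u₂ v₁ v₂ →
      (- u₂ * v₁ + u₁ * v₂) * d₁ ≡ (- d₂ * v₁ + d₁ * v₂) * u₁ - (- d₂ * u₁ + d₁ * u₂) * v₁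
    ring₁ = solve-∀
    ring₂ : ∀ d₁ d₂ u₁ u₂ v₁ v₂ →
      (- u₂ * v₁ + u₁ * v₂) * d₂ ≡ (- d₂ * v₁ + d₁ * v₂) * u₂ - (- d₂ * u₁ + d₁ * u₂) * v₂
    ring₂ = solve-∀

  ray-det : ∀ d₀ d a b →
    (d₀ · d₀) * (det b d + det d a) ≡ (d₀ · d) * (det b d₀ + det d₀ a) + det d₀ d * (b · d₀ - d₀ · a)
  ray-det (x₁ , x₂) (d₁ , d₂) (a₁ , a₂) (b₁ , b₂) = ring x₁ x₂ d₁ d₂ a₁ a₂ b₁ b₂
    where
    ring : ∀ x₁ x₂ d₁ d₂ a₁ a₂ b₁ b₂ →
      (x₁ * x₁ + x₂ * x₂) * (- b₂ * d₁ + b₁ * d₂ + (- d₂ * a₁ + d₁ * a₂))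
        ≡ (x₁ * d₁ + x₂ * d₂) * (- b₂ * x₁ + b₁ * x₂ + (- x₂ * a₁ + x₁ * a₂))
          + (- x₂ * d₁ + x₁ * d₂) * (b₁ * x₁ + b₂ * x₂ - (x₁ * a₁ + x₂ * a₂))
    ring = solve-∀

  segment-⊛ : ∀ u v → (v · v) ⊛ u ⊕ (- (u · v)) ⊛ v ⊕ 0ℤ ⊛ v ≡ det v u ⊛ perp v
  segment-⊛ (u₁ , u₂) (v₁ , v₂) = cong₂ _,_ (ring₁ u₁ u₂ v₁ v₂) (ring₂ u₁ u₂ v₁ v₂)
    where
    ring₁ : ∀ u₁ u₂ v₁ v₂ →
      (v₁ * v₁ + v₂ * v₂) * u₁ + - (u₁ * v₁ + u₂ * v₂) * v₁ + 0ℤ * v₁ ≡ (- v₂ * u₁ + v₁ * u₂) * - v₂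
    ring₁ = solve-∀
    ring₂ : ∀ u₁ u₂ v₁ v₂ →
      (v₁ * v₁ + v₂ * v₂) * u₂ + - (u₁ * v₁ + u₂ * v₂) * v₂ + 0ℤ * v₂ ≡ (- v₂ * u₁ + v₁ * u₂) * v₁
    ring₂ = solve-∀

  ⊛≡0²⇒≡0 : ∀ {k d} → d ≢ 0² → k ⊛ d ≡ 0² → k ≡ 0ℤ
  ⊛≡0²⇒≡0 d≢0 kd≡0 =
    Sum.[ i*j≡0∧j≢0⇒i≡0 (cong proj₁ kd≡0) , i*j≡0∧j≢0⇒i≡0 (cong proj₂ kd≡0) ]′ (≢0²⇒≢0⊎≢0 d≢0)

  ·≡0∧det≡0⇒≡0² : ∀ {d v} → d ≢ 0² → d · v ≡ 0ℤ → det d v ≡ 0ℤ → v ≡ 0²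
  ·≡0∧det≡0⇒≡0² {d} {v₁ , v₂} d≢0 d·v≡0 det≡0 =
    cong₂ _,_ (0<i∧i*j≡0⇒j≡0 0<d·d (cong proj₁ d·d⊛v≡0)) (0<i∧i*j≡0⇒j≡0 0<d·d (cong proj₂ d·d⊛v≡0))
    where
    0<d·d : 0ℤ < d · d
    0<d·d = d≢0²⇒0<d·d d≢0
    d·d⊛v≡0 : (d · d) ⊛ (v₁ , v₂) ≡ 0²
    d·d⊛v≡0 = begin
      (d · d) ⊛ (v₁ , v₂)                        ≡⟨ decompose d d (v₁ , v₂) ⟩
      (d · (v₁ , v₂)) ⊛ d ⊕ det d (v₁ , v₂) ⊛ perp d ≡⟨ cong₂ (λ x y → x ⊛ d ⊕ y ⊛ perp d) d·v≡0 det≡0 ⟩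
      0ℤ ⊛ d ⊕ 0ℤ ⊛ perp d                      ≡⟨⟩
      0²                                          ∎
      where open ≡-Reasoning

  det≡0∧det≡0⇒det≡0 : ∀ {d u v} → d ≢ 0² → det d u ≡ 0ℤ → det d v ≡ 0ℤ → det u v ≡ 0ℤ
  det≡0∧det≡0⇒det≡0 {d} {u} {v} d≢0 du≡0 dv≡0 = ⊛≡0²⇒≡0 d≢0 (begin
    det u v ⊛ d                    ≡⟨ collinear-⊛ d u v ⟩
    det d v ⊛ u ⊖ det d u ⊛ v      ≡⟨ cong₂ (λ x y → x ⊛ u ⊖ y ⊛ v) dv≡0 du≡0 ⟩
    0ℤ ⊛ u ⊖ 0ℤ ⊛ v                ≡⟨⟩
    0²                             ∎)
    where open ≡-Reasoning

  -- Jacobi's identity makes the counter-clockwise order transitive on every open half-plane.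
  det-trans : ∀ φ {u v w} → 0ℤ < φ · u → 0ℤ < φ · v → 0ℤ < φ · w →
              0ℤ ≤ det u v → 0ℤ ≤ det v w → 0ℤ ≤ det u w
  det-trans φ {u} {v} {w} φu φv φw uv vw =
    det-flip-≤ {w} {u} (i*j≤0∧0<j⇒i≤0 wu*φv≤0 φv)
    where
    wu*φv≤0 : det w u * (φ · v) ≤ 0ℤ
    wu*φv≤0 = x+y+z≡0⇒y≤0 (jacobi φ u v w) (0≤i*j vw (ℤP.<⇒≤ φu)) (0≤i*j uv (ℤP.<⇒≤ φw))

module Grid where

  open Signs
  open Plane
  open import Data.Nat using (ℕ)
  open import Data.Integer as ℤ using (ℤ; 0ℤ; _+_; _-_; -_; _≤_; _<_)
  import Data.Integer.Properties as ℤP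
  open import Data.Fin using (Fin)
  import Data.Fin.Properties as FinP
  open import Data.Product using (Σ; ∃; _×_; _,_; proj₁; proj₂)
  open import Data.Product.Properties using (≡-dec)
  open import Data.Sum as Sum using (_⊎_; inj₁; inj₂; [_,_]′)
  open import Data.List using (List; []; _∷_; map; allFin; cartesianProduct)
  open import Data.List.Membership.Propositional using (_∈_)
  open import Data.List.Membership.Propositional.Properties using (∈-allFin; ∈-cartesianProduct⁺; ∈-map⁺)
  open import Data.List.Relation.Unary.Any using (here; there)
  import Data.List.Relation.Unary.All as All
  open import Data.List.Extrema ℤP.≤-totalOrder using (max; xs≤max)
  open import Function using (id)
  open import Level using (0ℓ)
  open import Relation.Binary.Definitions using (DecidableEquality)
  open import Relation.Binary.Core using (Rel)
  open import Relation.Unary using (Pred; Decidable)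
  open import Relation.Nullary using (Dec; yes; no; ¬_)
  open import Relation.Nullary.Negation using (contradiction)
  open import Relation.Binary.PropositionalEquality

  private variable n : ℕ

  vec : Pt n → ℤ²
  vec (i , j) = zc i , zc j

  _≟ₚ_ : DecidableEquality (Pt n)
  _≟ₚ_ = ≡-dec FinP._≟_ FinP._≟_

  vec-injective : ∀ {p q : Pt n} → vec p ≡ vec q → p ≡ q
  vec-injective {p = i , j} {k , l} e =
    cong₂ _,_ (zc-injective (cong proj₁ e)) (zc-injective (cong proj₂ e))
    where
    zc-injective : ∀ {i k : Fin n} → zc i ≡ zc k → i ≡ k
    zc-injective e = FinP.toℕ-injective (ℤP.+-injective e)

  ⊖≡0²⇒≡ : ∀ {p q : Pt n} → vec p ⊖ vec q ≡ 0² → p ≡ q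
  ⊖≡0²⇒≡ e = vec-injective (cong₂ _,_ (ℤP.i-j≡0⇒i≡j _ _ (cong proj₁ e)) (ℤP.i-j≡0⇒i≡j _ _ (cong proj₂ e)))

  ≢⇒⊖≢0² : ∀ {p q : Pt n} → p ≢ q → vec p ⊖ vec q ≢ 0²
  ≢⇒⊖≢0² p≢q e = p≢q (⊖≡0²⇒≡ e)

  allPts : ∀ n → List (Pt n)
  allPts n = cartesianProduct (allFin n) (allFin n)

  ∈-allPts : (p : Pt n) → p ∈ allPts n
  ∈-allPts (i , j) = ∈-cartesianProduct⁺ (∈-allFin i) (∈-allFin j)

  any?ₚ : ∀ {P : Pred (Pt n) 0ℓ} → Decidable P → Dec (∃ P)
  any?ₚ P? with FinP.any? (λ i → FinP.any? (λ j → P? (i , j)))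
  ... | yes (i , j , Pij) = yes ((i , j) , Pij)
  ... | no ∄ = no λ ((i , j) , Pij) → ∄ (i , j , Pij)

  bounded : (g : Pt n → ℤ) → Σ ℤ λ M → ∀ s → g s ≤ M
  bounded {n} g = max 0ℤ gs , λ s → All.lookup (xs≤max 0ℤ gs) (∈-map⁺ g (∈-allPts s))
    where gs = map g (allPts n)

  bounded-difference : (g : Pt n → ℤ) → Σ ℤ λ B → ∀ s t → g s - g t ≤ B
  bounded-difference g =
    let M , g≤M = bounded g
        M′ , -g≤M′ = bounded (λ s → - g s)
    in M + M′ , λ s t → ℤP.+-mono-≤ (g≤M s) (-g≤M′ t)

  module _ {A : Set} {P : Pred A 0ℓ} (P? : Decidable P) {_≼_ : Rel A 0ℓ}
           (≼-total : ∀ {a b} → P a → P b → a ≼ b ⊎ b ≼ a)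
           (≼-trans : ∀ {a b c} → P a → P b → P c → a ≼ b → b ≼ c → a ≼ c) where

    maximum-of : ∀ xs {a} → P a → Σ A λ m → P m × a ≼ m × (∀ {b} → b ∈ xs → P b → b ≼ m)
    maximum-of [] pa = _ , pa , [ id , id ]′ (≼-total pa pa) , λ ()
    maximum-of (b ∷ xs) {a} pa with P? b
    ... | no ¬pb = let m , pm , a≼m , max = maximum-of xs pa in
      m , pm , a≼m , λ { (here refl) pb → contradiction pb ¬pb ; (there b∈) → max b∈ }
    ... | yes pb with ≼-total pa pb
    ...   | inj₁ a≼b = let m , pm , b≼m , max = maximum-of xs pb in
      m , pm , ≼-trans pa pb pm a≼b b≼m , λ { (here refl) _ → b≼m ; (there c∈) → max c∈ }
    ...   | inj₂ b≼a = let m , pm , a≼m , max = maximum-of xs pa in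
      m , pm , a≼m , λ { (here refl) _ → ≼-trans pb pa pm b≼a a≼m ; (there c∈) → max c∈ }

  maximum : ∀ {P : Pred (Pt n) 0ℓ} (P? : Decidable P) {_≼_ : Rel (Pt n) 0ℓ} →
            (∀ {a b} → P a → P b → a ≼ b ⊎ b ≼ a) →
            (∀ {a b c} → P a → P b → P c → a ≼ b → b ≼ c → a ≼ c) →
            ∀ {a} → P a → Σ (Pt n) λ m → P m × (∀ {b} → P b → b ≼ m)
  maximum {n} P? ≼-total ≼-trans pa =
    let m , pm , _ , max = maximum-of P? ≼-total ≼-trans (allPts n) pa in m , pm , λ {b} → max (∈-allPts b)

  module _ {W : Pred (Pt n) 0ℓ} (W? : Decidable W) (w : Pt n → ℤ²) (φ : ℤ²)
           (in-front : ∀ {s} → W s → 0ℤ < φ · w s) where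

    angular-max : ∀ {s₀} → W s₀ → Σ (Pt n) λ m → W m × (∀ {s} → W s → 0ℤ ≤ det (w s) (w m))
    angular-max = maximum W? total λ Wa Wb Wc → det-trans φ (in-front Wa) (in-front Wb) (in-front Wc)
      where
      total : ∀ {a b} → W a → W b → 0ℤ ≤ det (w a) (w b) ⊎ 0ℤ ≤ det (w b) (w a)
      total {a} {b} _ _ = Sum.map₂ (det-flip-≤ {w a} {w b}) (ℤP.≤-total 0ℤ (det (w a) (w b)))

  angular-min : ∀ {W : Pred (Pt n) 0ℓ} (W? : Decidable W) (w : Pt n → ℤ²) (φ : ℤ²) →
                (∀ {s} → W s → 0ℤ < φ · w s) →
                ∀ {s₀} → W s₀ → Σ (Pt n) λ m → W m × (∀ {s} → W s → 0ℤ ≤ det (w m) (w s))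
  angular-min W? w φ in-front W₀ =
    let m , Wm , min = angular-max W? (λ s → swap (w s)) (swap φ) (λ {s} Ws → subst (0ℤ <_) (sym (·-swap φ (w s))) (in-front Ws)) W₀
    in m , Wm , λ {s} Ws → subst (0ℤ ≤_) (det-swap (w s) (w m)) (min Ws)

module Hull where

  open Signs
  open Plane
  open Grid
  open import Data.Nat as ℕ using (ℕ; zero; suc)
  open import Data.Integer as ℤ using (ℤ; +_; -[1+_]; 0ℤ)
  import Data.Integer.Properties as ℤP
  open import Data.Integer.Tactic.RingSolver using (solve-∀)
  open import Data.Rational as ℚ using (ℚ; mkℚ; 0ℚ; 1ℚ; _+_; _*_; _≤_)
  import Data.Rational.Properties as ℚP
  import Data.Rational.Unnormalised as ℚᵘ
  import Data.Rational.Unnormalised.Properties as ℚᵘP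
  import Data.Nat.Coprimality as Coprimality
  open import Data.Fin as Fin using (Fin)
  import Data.Fin.Properties as FinP
  open import Data.Bool using (if_then_else_)
  open import Data.Product using (Σ; _,_; proj₁; proj₂)
  open import Data.Sum using (_⊎_; inj₁; inj₂)
  open import Data.Maybe using (nothing)
  open import Level using (0ℓ)
  open import Relation.Nullary using (does; yes; no)
  open import Relation.Nullary.Negation using (contradiction)
  open import Relation.Binary.PropositionalEquality
  import Tactic.RingSolver as RingSolver
  import Tactic.RingSolver.Core.AlmostCommutativeRing as ACR

  private variable n : ℕ

  ℚ-ring : ACR.AlmostCommutativeRing 0ℓ 0ℓ
  ℚ-ring = ACR.fromCommutativeRing ℚP.+-*-commutativeRing (λ _ → nothing)

  -- ι (zc i) is definitionally qc i.
  ι : ℤ → ℚ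
  ι i = i ℚ./ 1

  private
    coprime-1 : ∀ m → Coprimality.Coprime m 1
    coprime-1 m = Coprimality.sym (Coprimality.1-coprimeTo m)

    ι≡mkℚ : ∀ i → ι i ≡ mkℚ i 0 (coprime-1 ℤ.∣ i ∣)
    ι≡mkℚ (+ m) = ℚP.normalize-coprime (coprime-1 m)
    ι≡mkℚ -[1+ m ] = cong ℚ.-_ (ℚP.normalize-coprime (coprime-1 (suc m)))

    toℚᵘ-ι : ∀ i → ℚ.toℚᵘ (ι i) ≡ ℚᵘ.mkℚᵘ i 0
    toℚᵘ-ι i rewrite ι≡mkℚ i = refl

  ι-+ : ∀ i j → ι (i ℤ.+ j) ≡ ι i + ι j
  ι-+ i j = ℚP.toℚᵘ-injective (begin
    ℚ.toℚᵘ (ι (i ℤ.+ j))               ≡⟨ toℚᵘ-ι (i ℤ.+ j) ⟩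
    ℚᵘ.mkℚᵘ (i ℤ.+ j) 0                ≈⟨ ℚᵘ.*≡* (ring i j) ⟩
    ℚᵘ.mkℚᵘ i 0 ℚᵘ.+ ℚᵘ.mkℚᵘ j 0       ≡⟨ sym (cong₂ ℚᵘ._+_ (toℚᵘ-ι i) (toℚᵘ-ι j)) ⟩
    ℚ.toℚᵘ (ι i) ℚᵘ.+ ℚ.toℚᵘ (ι j)     ≈⟨ ℚᵘP.≃-sym (ℚP.toℚᵘ-homo-+ (ι i) (ι j)) ⟩
    ℚ.toℚᵘ (ι i + ι j)                 ∎)
    where
    open ℚᵘP.≃-Reasoning
    ring : ∀ i j → (i ℤ.+ j) ℤ.* (+ 1 ℤ.* + 1) ≡ (i ℤ.* + 1 ℤ.+ j ℤ.* + 1) ℤ.* + 1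
    ring = solve-∀

  ι-* : ∀ i j → ι (i ℤ.* j) ≡ ι i * ι j
  ι-* i j = ℚP.toℚᵘ-injective (begin
    ℚ.toℚᵘ (ι (i ℤ.* j))               ≡⟨ toℚᵘ-ι (i ℤ.* j) ⟩
    ℚᵘ.mkℚᵘ (i ℤ.* j) 0                ≈⟨ ℚᵘ.*≡* (ring i j) ⟩
    ℚᵘ.mkℚᵘ i 0 ℚᵘ.* ℚᵘ.mkℚᵘ j 0       ≡⟨ sym (cong₂ ℚᵘ._*_ (toℚᵘ-ι i) (toℚᵘ-ι j)) ⟩
    ℚ.toℚᵘ (ι i) ℚᵘ.* ℚ.toℚᵘ (ι j)     ≈⟨ ℚᵘP.≃-sym (ℚP.toℚᵘ-homo-* (ι i) (ι j)) ⟩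
    ℚ.toℚᵘ (ι i * ι j)                 ∎)
    where
    open ℚᵘP.≃-Reasoning
    ring : ∀ i j → (i ℤ.* j) ℤ.* (+ 1 ℤ.* + 1) ≡ (i ℤ.* j) ℤ.* + 1
    ring = solve-∀

  ι-mono-≤ : ∀ {i j} → i ℤ.≤ j → ι i ≤ ι j
  ι-mono-≤ {i} {j} i≤j = ℚP.toℚᵘ-cancel-≤ (subst₂ ℚᵘ._≤_ (sym (toℚᵘ-ι i)) (sym (toℚᵘ-ι j))
    (ℚᵘ.*≤* (subst₂ ℤ._≤_ (sym (ℤP.*-identityʳ i)) (sym (ℤP.*-identityʳ j)) i≤j)))

  ι-cancel-≤ : ∀ {i j} → ι i ≤ ι j → i ℤ.≤ j
  ι-cancel-≤ {i} {j} ιi≤ιj with subst₂ ℚᵘ._≤_ (toℚᵘ-ι i) (toℚᵘ-ι j) (ℚP.toℚᵘ-mono-≤ ιi≤ιj)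
  ... | ℚᵘ.*≤* i*1≤j*1 = subst₂ ℤ._≤_ (ℤP.*-identityʳ i) (ℤP.*-identityʳ j) i*1≤j*1

  ι-· : ∀ a (z : Pt n) → ι (proj₁ a) * qc (proj₁ z) + ι (proj₂ a) * qc (proj₂ z) ≡ ι (a · vec z)
  ι-· (a₁ , a₂) (z₁ , z₂) = sym (trans (ι-+ (a₁ ℤ.* zc z₁) (a₂ ℤ.* zc z₂)) (cong₂ _+_ (ι-* a₁ (zc z₁)) (ι-* a₂ (zc z₂))))

  Σℚ-cong : ∀ m {g h : Fin m → ℚ} → (∀ i → g i ≡ h i) → Σℚ m g ≡ Σℚ m h
  Σℚ-cong zero    g≗h = refl
  Σℚ-cong (suc m) g≗h = cong₂ _+_ (g≗h Fin.zero) (Σℚ-cong m (λ i → g≗h (Fin.suc i)))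

  Σℚ-+ : ∀ m (g h : Fin m → ℚ) → Σℚ m (λ i → g i + h i) ≡ Σℚ m g + Σℚ m h
  Σℚ-+ zero    g h = refl
  Σℚ-+ (suc m) g h = trans (cong (λ s → g Fin.zero + h Fin.zero + s) (Σℚ-+ m _ _)) (ring (g Fin.zero) (h Fin.zero) (Σℚ m (λ i → g (Fin.suc i))) (Σℚ m (λ i → h (Fin.suc i))))
    where
    ring : ∀ a b c d → a + b + (c + d) ≡ a + c + (b + d)
    ring = RingSolver.solve-∀ ℚ-ring

  Σℚ-*ˡ : ∀ m c (h : Fin m → ℚ) → Σℚ m (λ i → c * h i) ≡ c * Σℚ m h
  Σℚ-*ˡ zero    c h = sym (ℚP.*-zeroʳ c)
  Σℚ-*ˡ (suc m) c h = trans (cong (λ s → c * h Fin.zero + s) (Σℚ-*ˡ m c _)) (sym (ℚP.*-distribˡ-+ c _ _))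

  Σℚ-mono-≤ : ∀ m {g h : Fin m → ℚ} → (∀ i → g i ≤ h i) → Σℚ m g ≤ Σℚ m h
  Σℚ-mono-≤ zero    g≤h = ℚP.≤-refl
  Σℚ-mono-≤ (suc m) g≤h = ℚP.+-mono-≤ (g≤h Fin.zero) (Σℚ-mono-≤ m (λ i → g≤h (Fin.suc i)))

  δ : ∀ {m} → Fin m → Fin m → ℚ
  δ a i = if does (i FinP.≟ a) then 1ℚ else 0ℚ

  Σℚ-δ : ∀ m a (h : Fin m → ℚ) → Σℚ m (λ i → δ a i * h i) ≡ h a
  Σℚ-δ (suc m) Fin.zero    h = begin
    1ℚ * h Fin.zero + Σℚ m (λ i → 0ℚ * h (Fin.suc i)) ≡⟨ cong₂ _+_ (ℚP.*-identityˡ (h Fin.zero)) (Σℚ-cong m (λ i → ℚP.*-zeroˡ (h (Fin.suc i)))) ⟩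
    h Fin.zero + Σℚ m (λ _ → 0ℚ)                        ≡⟨ cong (λ s → h Fin.zero + s) (trans (Σℚ-*ˡ m 0ℚ (λ _ → 0ℚ)) (ℚP.*-zeroˡ (Σℚ m (λ _ → 0ℚ)))) ⟩
    h Fin.zero + 0ℚ                                     ≡⟨ ℚP.+-identityʳ _ ⟩
    h Fin.zero                                          ∎
    where open ≡-Reasoning
  Σℚ-δ (suc m) (Fin.suc a) h =
    trans (cong₂ _+_ (ℚP.*-zeroˡ (h Fin.zero)) (Σℚ-δ m a (λ i → h (Fin.suc i)))) (ℚP.+-identityˡ _)

  δ-nonNeg : ∀ {m} (a i : Fin m) → 0ℚ ≤ δ a i
  δ-nonNeg a i with i FinP.≟ a
  ... | yes _ = ℚP.nonNegative⁻¹ 1ℚ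
  ... | no _  = ℚP.≤-refl

  δ≢0⇒≡ : ∀ {m} {a i : Fin m} → δ a i ≢ 0ℚ → i ≡ a
  δ≢0⇒≡ {a = a} {i} δ≢0 with i FinP.≟ a
  ... | yes i≡a = i≡a
  ... | no _    = contradiction refl δ≢0

  ΣPt-cong : ∀ n {g h : Pt n → ℚ} → (∀ p → g p ≡ h p) → ΣPt n g ≡ ΣPt n h
  ΣPt-cong n g≗h = Σℚ-cong n (λ i → Σℚ-cong n (λ j → g≗h (i , j)))

  ΣPt-+ : ∀ n (g h : Pt n → ℚ) → ΣPt n (λ p → g p + h p) ≡ ΣPt n g + ΣPt n h
  ΣPt-+ n g h = trans (Σℚ-cong n (λ i → Σℚ-+ n _ _)) (Σℚ-+ n _ _)

  ΣPt-*ˡ : ∀ n c (h : Pt n → ℚ) → ΣPt n (λ p → c * h p) ≡ c * ΣPt n h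
  ΣPt-*ˡ n c h = trans (Σℚ-cong n (λ i → Σℚ-*ˡ n c _)) (Σℚ-*ˡ n c _)

  ΣPt-mono-≤ : ∀ n {g h : Pt n → ℚ} → (∀ p → g p ≤ h p) → ΣPt n g ≤ ΣPt n h
  ΣPt-mono-≤ n g≤h = Σℚ-mono-≤ n (λ i → Σℚ-mono-≤ n (λ j → g≤h (i , j)))

  δₚ : Pt n → Pt n → ℚ
  δₚ (a , b) (i , j) = δ a i * δ b j

  ΣPt-δₚ : ∀ n s (h : Pt n → ℚ) → ΣPt n (λ p → δₚ s p * h p) ≡ h s
  ΣPt-δₚ n (a , b) h = begin
    Σℚ n (λ i → Σℚ n (λ j → δ a i * δ b j * h (i , j)))   ≡⟨ Σℚ-cong n (λ i → Σℚ-cong n (λ j → ℚP.*-assoc (δ a i) _ _)) ⟩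
    Σℚ n (λ i → Σℚ n (λ j → δ a i * (δ b j * h (i , j)))) ≡⟨ Σℚ-cong n (λ i → Σℚ-*ˡ n (δ a i) _) ⟩
    Σℚ n (λ i → δ a i * Σℚ n (λ j → δ b j * h (i , j)))   ≡⟨ Σℚ-cong n (λ i → cong (δ a i *_) (Σℚ-δ n b _)) ⟩
    Σℚ n (λ i → δ a i * h (i , b))                        ≡⟨ Σℚ-δ n a _ ⟩
    h (a , b)                                             ∎
    where open ≡-Reasoning

  δₚ-nonNeg : ∀ (s p : Pt n) → 0ℚ ≤ δₚ s p
  δₚ-nonNeg (a , b) (i , j) = ℚP.nonNegative⁻¹ _ {{ℚP.nonNeg*nonNeg⇒nonNeg (δ a i) {{ℚ.nonNegative (δ-nonNeg a i)}} (δ b j) {{ℚ.nonNegative (δ-nonNeg b j)}}}}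

  δₚ≢0⇒≡ : ∀ {s p : Pt n} → δₚ s p ≢ 0ℚ → p ≡ s
  δₚ≢0⇒≡ {s = a , b} {i , j} δ≢0 = cong₂ _,_ (δ≢0⇒≡ (λ δa≡0 → δ≢0 (trans (cong (_* δ b j) δa≡0) (ℚP.*-zeroˡ (δ b j)))))
                                            (δ≢0⇒≡ (λ δb≡0 → δ≢0 (trans (cong (δ a i *_) δb≡0) (ℚP.*-zeroʳ (δ a i)))))

  InConv-≤ : ∀ {S : Pt n → Set} {x₁ x₂} b₁ b₂ b₀ →
             (∀ p → S p → b₁ * qc (proj₁ p) + b₂ * qc (proj₂ p) ≤ b₀) →
             InConv n S x₁ x₂ → b₁ * x₁ + b₂ * x₂ ≤ b₀
  InConv-≤ {n} b₁ b₂ b₀ valid (w , 0≤w , supp , Σw≡1 , refl , refl) = begin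
    b₁ * ΣPt n (λ p → w p * x₁ p) + b₂ * ΣPt n (λ p → w p * x₂ p)
      ≡⟨ sym (cong₂ _+_ (ΣPt-*ˡ n b₁ _) (ΣPt-*ˡ n b₂ _)) ⟩
    ΣPt n (λ p → b₁ * (w p * x₁ p)) + ΣPt n (λ p → b₂ * (w p * x₂ p))
      ≡⟨ sym (ΣPt-+ n _ _) ⟩
    ΣPt n (λ p → b₁ * (w p * x₁ p) + b₂ * (w p * x₂ p))
      ≡⟨ ΣPt-cong n (λ p → ring b₁ b₂ (w p) (x₁ p) (x₂ p)) ⟩
    ΣPt n (λ p → w p * (b₁ * x₁ p + b₂ * x₂ p))
      ≤⟨ ΣPt-mono-≤ n weighted ⟩
    ΣPt n (λ p → b₀ * w p)
      ≡⟨ ΣPt-*ˡ n b₀ w ⟩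
    b₀ * ΣPt n w
      ≡⟨ trans (cong (b₀ *_) Σw≡1) (ℚP.*-identityʳ b₀) ⟩
    b₀ ∎
    where
    open ℚP.≤-Reasoning
    x₁ x₂ : Pt n → ℚ
    x₁ p = qc (proj₁ p)
    x₂ p = qc (proj₂ p)
    ring : ∀ b₁ b₂ w x y → b₁ * (w * x) + b₂ * (w * y) ≡ w * (b₁ * x + b₂ * y)
    ring = RingSolver.solve-∀ ℚ-ring
    weighted : ∀ p → w p * (b₁ * x₁ p + b₂ * x₂ p) ≤ b₀ * w p
    weighted p with w p ℚP.≟ 0ℚ
    ... | yes wp≡0 = ℚP.≤-reflexive (begin-equality
      w p * (b₁ * x₁ p + b₂ * x₂ p) ≡⟨ cong (_* (b₁ * x₁ p + b₂ * x₂ p)) wp≡0 ⟩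
      0ℚ * (b₁ * x₁ p + b₂ * x₂ p)  ≡⟨ ℚP.*-zeroˡ (b₁ * x₁ p + b₂ * x₂ p) ⟩
      0ℚ                            ≡⟨ sym (ℚP.*-zeroʳ b₀) ⟩
      b₀ * 0ℚ                       ≡⟨ cong (b₀ *_) wp≡0 ⟨
      b₀ * w p                      ∎)
    ... | no wp≢0 = ℚP.≤-trans (ℚP.*-monoˡ-≤-nonNeg (w p) {{ℚ.nonNegative (0≤w p)}} (valid p (supp p wp≢0)))
                               (ℚP.≤-reflexive (ℚP.*-comm (w p) b₀))

  InConv-mono : ∀ {S S′ : Pt n → Set} {x₁ x₂} → (∀ {p} → S p → S′ p) → InConv n S x₁ x₂ → InConv n S′ x₁ x₂
  InConv-mono S⊆S′ (w , 0≤w , supp , rest) = w , 0≤w , (λ p wp≢0 → S⊆S′ (supp p wp≢0)) , rest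

  InHull : ∀ n → (Pt n → Set) → Pt n → Set
  InHull n S y = InConv n S (qc (proj₁ y)) (qc (proj₂ y))

  record Barycentric (z u v w : ℤ²) : Set where
    constructor barycentric
    field
      l₁ l₂ l₃ : ℤ
      0≤l₁     : 0ℤ ℤ.≤ l₁
      0≤l₂     : 0ℤ ℤ.≤ l₂
      0≤l₃     : 0ℤ ℤ.≤ l₃
      0<Σl     : 0ℤ ℤ.< l₁ ℤ.+ l₂ ℤ.+ l₃
      balanced : l₁ ⊛ (u ⊖ z) ⊕ l₂ ⊛ (v ⊖ z) ⊕ l₃ ⊛ (w ⊖ z) ≡ 0²

  module _ {n} (s₁ s₂ s₃ : Pt n) (μ₁ μ₂ μ₃ : ℚ) where

    mix₃ : Pt n → ℚ
    mix₃ p = μ₁ * δₚ s₁ p + μ₂ * δₚ s₂ p + μ₃ * δₚ s₃ p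

    ΣPt-mix₃ : ∀ h → ΣPt n (λ p → mix₃ p * h p) ≡ μ₁ * h s₁ + μ₂ * h s₂ + μ₃ * h s₃
    ΣPt-mix₃ h = begin
      ΣPt n (λ p → mix₃ p * h p)
        ≡⟨ ΣPt-cong n (λ p → ring μ₁ μ₂ μ₃ (δₚ s₁ p) (δₚ s₂ p) (δₚ s₃ p) (h p)) ⟩
      ΣPt n (λ p → μ₁ * (δₚ s₁ p * h p) + μ₂ * (δₚ s₂ p * h p) + μ₃ * (δₚ s₃ p * h p))
        ≡⟨ trans (ΣPt-+ n _ _) (cong (_+ ΣPt n (λ p → μ₃ * (δₚ s₃ p * h p))) (ΣPt-+ n _ _)) ⟩
      ΣPt n (λ p → μ₁ * (δₚ s₁ p * h p)) + ΣPt n (λ p → μ₂ * (δₚ s₂ p * h p)) + ΣPt n (λ p → μ₃ * (δₚ s₃ p * h p))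
        ≡⟨ cong₂ _+_ (cong₂ _+_ (pick μ₁ s₁) (pick μ₂ s₂)) (pick μ₃ s₃) ⟩
      μ₁ * h s₁ + μ₂ * h s₂ + μ₃ * h s₃ ∎
      where
      open ≡-Reasoning
      ring : ∀ a b c i j k h → (a * i + b * j + c * k) * h ≡ a * (i * h) + b * (j * h) + c * (k * h)
      ring = RingSolver.solve-∀ ℚ-ring
      pick : ∀ μ s → ΣPt n (λ p → μ * (δₚ s p * h p)) ≡ μ * h s
      pick μ s = trans (ΣPt-*ˡ n μ _) (cong (μ *_) (ΣPt-δₚ n s h))

    mix₃-nonNeg : 0ℚ ≤ μ₁ → 0ℚ ≤ μ₂ → 0ℚ ≤ μ₃ → ∀ p → 0ℚ ≤ mix₃ p
    mix₃-nonNeg 0≤μ₁ 0≤μ₂ 0≤μ₃ p = ℚP.+-mono-≤ (ℚP.+-mono-≤ (0≤μδ 0≤μ₁ s₁) (0≤μδ 0≤μ₂ s₂)) (0≤μδ 0≤μ₃ s₃)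
      where
      0≤μδ : ∀ {μ} → 0ℚ ≤ μ → ∀ s → 0ℚ ≤ μ * δₚ s p
      0≤μδ {μ} 0≤μ s = ℚP.nonNegative⁻¹ _ {{ℚP.nonNeg*nonNeg⇒nonNeg μ {{ℚ.nonNegative 0≤μ}} (δₚ s p) {{ℚ.nonNegative (δₚ-nonNeg s p)}}}}

    mix₃-support : ∀ p → mix₃ p ≢ 0ℚ → p ≡ s₁ ⊎ p ≡ s₂ ⊎ p ≡ s₃
    mix₃-support p mix≢0 with p ≟ₚ s₁ | p ≟ₚ s₂ | p ≟ₚ s₃
    ... | yes p≡s₁ | _ | _ = inj₁ p≡s₁
    ... | _ | yes p≡s₂ | _ = inj₂ (inj₁ p≡s₂)
    ... | _ | _ | yes p≡s₃ = inj₂ (inj₂ p≡s₃)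
    ... | no p≢s₁ | no p≢s₂ | no p≢s₃ =
      contradiction (cong₂ _+_ (cong₂ _+_ (vanish μ₁ p≢s₁) (vanish μ₂ p≢s₂)) (vanish μ₃ p≢s₃)) mix≢0
      where
      vanish : ∀ μ {s} → p ≢ s → μ * δₚ s p ≡ 0ℚ
      vanish μ {s} p≢s with δₚ s p ℚP.≟ 0ℚ
      ... | yes δ≡0 = trans (cong (μ *_) δ≡0) (ℚP.*-zeroʳ μ)
      ... | no δ≢0  = contradiction (δₚ≢0⇒≡ δ≢0) p≢s

  module BarycentricWeights {x s₁ s₂ s₃ : Pt n} (bary : Barycentric (vec x) (vec s₁) (vec s₂) (vec s₃)) where

    open Barycentric bary

    private
      Λ : ℤ
      Λ = l₁ ℤ.+ l₂ ℤ.+ l₃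

      0<ιΛ : 0ℚ ℚ.< ι Λ
      0<ιΛ = ℚP.<-≤-trans (ℚP.positive⁻¹ 1ℚ) (ι-mono-≤ (ℤP.i<j⇒suc[i]≤j 0<Σl))

      instance
        ιΛ≢0 : ℚ.NonZero (ι Λ)
        ιΛ≢0 = ℚP.pos⇒nonZero (ι Λ) {{ℚ.positive 0<ιΛ}}

      r : ℚ
      r = ℚ.1/ ι Λ

      r-ιΛ : ∀ q → r * (ι Λ * q) ≡ q
      r-ιΛ q = trans (sym (ℚP.*-assoc r (ι Λ) q)) (trans (cong (_* q) (ℚP.*-inverseˡ (ι Λ))) (ℚP.*-identityˡ q))

      μ : ℤ → ℚ
      μ l = ι l * r

      0≤μ : ∀ {l} → 0ℤ ℤ.≤ l → 0ℚ ≤ μ l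
      0≤μ {l} 0≤l = ℚP.nonNegative⁻¹ _ {{ℚP.nonNeg*nonNeg⇒nonNeg (ι l) {{ℚ.nonNegative (ι-mono-≤ 0≤l)}} r
                      {{ℚP.pos⇒nonNeg r {{ℚP.1/pos⇒pos (ι Λ) {{ℚ.positive 0<ιΛ}}}}}}}}

      average : ∀ a b c z → l₁ ℤ.* (a ℤ.- z) ℤ.+ l₂ ℤ.* (b ℤ.- z) ℤ.+ l₃ ℤ.* (c ℤ.- z) ≡ 0ℤ →
                μ l₁ * ι a + μ l₂ * ι b + μ l₃ * ι c ≡ ι z
      average a b c z bal = begin
        μ l₁ * ι a + μ l₂ * ι b + μ l₃ * ι c
          ≡⟨ ring (ι l₁) (ι l₂) (ι l₃) r (ι a) (ι b) (ι c) ⟩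
        r * (ι l₁ * ι a + ι l₂ * ι b + ι l₃ * ι c)
          ≡⟨ cong (r *_) (sym (trans (ι-+ (l₁ ℤ.* a ℤ.+ l₂ ℤ.* b) (l₃ ℤ.* c))
                              (cong₂ _+_ (trans (ι-+ (l₁ ℤ.* a) (l₂ ℤ.* b)) (cong₂ _+_ (ι-* l₁ a) (ι-* l₂ b))) (ι-* l₃ c)))) ⟩
        r * ι (l₁ ℤ.* a ℤ.+ l₂ ℤ.* b ℤ.+ l₃ ℤ.* c)
          ≡⟨ cong (λ t → r * ι t) (balanced⇒weighted-sum {l₁} {l₂} {l₃} {a} {b} {c} {z} bal) ⟩
        r * ι (Λ ℤ.* z)
          ≡⟨ trans (cong (r *_) (ι-* Λ z)) (r-ιΛ (ι z)) ⟩
        ι z ∎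
        where
        open ≡-Reasoning
        ring : ∀ x y z r a b c → x * r * a + y * r * b + z * r * c ≡ r * (x * a + y * b + z * c)
        ring = RingSolver.solve-∀ ℚ-ring

    weights : Pt n → ℚ
    weights = mix₃ s₁ s₂ s₃ (μ l₁) (μ l₂) (μ l₃)

    weights-nonNeg : ∀ p → 0ℚ ≤ weights p
    weights-nonNeg = mix₃-nonNeg s₁ s₂ s₃ (μ l₁) (μ l₂) (μ l₃) (0≤μ 0≤l₁) (0≤μ 0≤l₂) (0≤μ 0≤l₃)

    weights-support : ∀ p → weights p ≢ 0ℚ → p ≡ s₁ ⊎ p ≡ s₂ ⊎ p ≡ s₃
    weights-support = mix₃-support s₁ s₂ s₃ (μ l₁) (μ l₂) (μ l₃)

    Σweights≡1 : ΣPt n weights ≡ 1ℚ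
    Σweights≡1 = begin
      ΣPt n weights                                   ≡⟨ ΣPt-cong n (λ p → sym (ℚP.*-identityʳ (weights p))) ⟩
      ΣPt n (λ p → weights p * ι (+ 1))               ≡⟨ ΣPt-mix₃ s₁ s₂ s₃ (μ l₁) (μ l₂) (μ l₃) (λ _ → ι (+ 1)) ⟩
      μ l₁ * ι (+ 1) + μ l₂ * ι (+ 1) + μ l₃ * ι (+ 1) ≡⟨ average (+ 1) (+ 1) (+ 1) (+ 1) (ring l₁ l₂ l₃) ⟩
      1ℚ                                              ∎
      where
      open ≡-Reasoning
      ring : ∀ l₁ l₂ l₃ → l₁ ℤ.* (+ 1 ℤ.- + 1) ℤ.+ l₂ ℤ.* (+ 1 ℤ.- + 1) ℤ.+ l₃ ℤ.* (+ 1 ℤ.- + 1) ≡ 0ℤ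
      ring = solve-∀

    Σweights-coordinate : (π : Pt n → Fin n) →
      l₁ ℤ.* (zc (π s₁) ℤ.- zc (π x)) ℤ.+ l₂ ℤ.* (zc (π s₂) ℤ.- zc (π x)) ℤ.+ l₃ ℤ.* (zc (π s₃) ℤ.- zc (π x)) ≡ 0ℤ →
      ΣPt n (λ p → weights p * qc (π p)) ≡ qc (π x)
    Σweights-coordinate π bal =
      trans (ΣPt-mix₃ s₁ s₂ s₃ (μ l₁) (μ l₂) (μ l₃) (λ p → qc (π p))) (average (zc (π s₁)) (zc (π s₂)) (zc (π s₃)) (zc (π x)) bal)

  barycentric⇒InHull : ∀ {S : Pt n → Set} {x s₁ s₂ s₃} → S s₁ → S s₂ → S s₃ →
                       Barycentric (vec x) (vec s₁) (vec s₂) (vec s₃) → InHull n S x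
  barycentric⇒InHull {S = S} S₁ S₂ S₃ bary =
    weights , weights-nonNeg , support , Σweights≡1 ,
    Σweights-coordinate proj₁ (cong proj₁ balanced) , Σweights-coordinate proj₂ (cong proj₂ balanced)
    where
    open BarycentricWeights bary
    open Barycentric bary using (balanced)
    support : ∀ p → weights p ≢ 0ℚ → S p
    support p wp≢0 with weights-support p wp≢0
    ... | inj₁ refl        = S₁
    ... | inj₂ (inj₁ refl) = S₂
    ... | inj₂ (inj₂ refl) = S₃

  toFin : ∀ {z} → 0ℤ ℤ.≤ z → z ℤ.< + n → Σ (Fin n) λ i → zc i ≡ z
  toFin (ℤ.+≤+ _) (ℤ.+<+ k<n) = Fin.fromℕ< k<n , cong +_ (FinP.toℕ-fromℕ< k<n)

  barycentric-on-grid : ∀ {z} {s₁ s₂ s₃ : Pt n} → Barycentric z (vec s₁) (vec s₂) (vec s₃) → Σ (Pt n) λ Z → vec Z ≡ z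
  barycentric-on-grid {n} {z₁ , z₂} {s₁} {s₂} {s₃} (barycentric l₁ l₂ l₃ 0≤l₁ 0≤l₂ 0≤l₃ 0<Σl bal) =
    let i , zcᵢ≡z₁ = coordinate proj₁ (cong proj₁ bal)
        j , zcⱼ≡z₂ = coordinate proj₂ (cong proj₂ bal)
    in (i , j) , cong₂ _,_ zcᵢ≡z₁ zcⱼ≡z₂
    where
    0≤zc : (i : Fin n) → 0ℤ ℤ.≤ zc i
    0≤zc i = ℤ.+≤+ ℕ.z≤n
    zc≤pred[n] : (i : Fin n) → zc i ℤ.≤ ℤ.pred (+ n)
    zc≤pred[n] i = ℤP.i<j⇒i≤pred[j] (ℤ.+<+ (FinP.toℕ<n i))
    coordinate : ∀ {z} (π : Pt n → Fin n) →
      l₁ ℤ.* (zc (π s₁) ℤ.- z) ℤ.+ l₂ ℤ.* (zc (π s₂) ℤ.- z) ℤ.+ l₃ ℤ.* (zc (π s₃) ℤ.- z) ≡ 0ℤ →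
      Σ (Fin n) λ i → zc i ≡ z
    coordinate {z} π bal = toFin
      (balanced-≥ {z = z} 0≤l₁ 0≤l₂ 0≤l₃ 0<Σl bal (0≤zc (π s₁)) (0≤zc (π s₂)) (0≤zc (π s₃)))
      (ℤP.i≤pred[j]⇒i<j (balanced-≤ {z = z} 0≤l₁ 0≤l₂ 0≤l₃ 0<Σl bal (zc≤pred[n] (π s₁)) (zc≤pred[n] (π s₂)) (zc≤pred[n] (π s₃))))

module Separation where

  open Signs
  open Plane
  open Grid
  open Hull
  open import Data.Nat using (ℕ)
  open import Data.Integer as ℤ using (ℤ; 0ℤ; _+_; _*_; _-_; -_; _≤_; _<_)
  import Data.Integer.Properties as ℤP
  open import Data.Product using (Σ; ∃; _×_; _,_; proj₁; proj₂)
  open import Data.Sum as Sum using (_⊎_; inj₁; inj₂)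
  open import Level using (0ℓ)
  open import Relation.Unary using (Pred; Decidable)
  open import Relation.Nullary using (Dec; yes; no; ¬_)
  open import Relation.Nullary.Decidable using (_×-dec_)
  open import Relation.Nullary.Negation using (contradiction)
  open import Relation.Binary.Definitions using (Tri; tri<; tri≈; tri>)
  open import Relation.Binary.PropositionalEquality

  private variable n : ℕ

  Separated : (Pt n → Set) → Pt n → Set
  Separated S y = Σ ℤ² λ c → ∀ {s} → S s → c · vec s < c · vec y

  module _ {T : Pred (Pt n) 0ℓ} (T? : Decidable T) {x : Pt n} (x∉T : ∀ {s} → T s → s ≢ x) where

    private
      u : Pt n → ℤ²
      u s = vec s ⊖ vec x

      separated-by : ∀ c → (∀ {s} → T s → c · u s < 0ℤ) → Separated T x
      separated-by c below = c , λ {s} Ts → i-j<0⇒i<j (subst (_< 0ℤ) (·-⊖ c (vec s) (vec x)) (below Ts))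

    module _ {s₀} (T₀ : T s₀) where

      private
        d₀ : ℤ²
        d₀ = u s₀

        d₀≢0² : d₀ ≢ 0²
        d₀≢0² = ≢⇒⊖≢0² (x∉T T₀)

        Opposite Left Right : Pred (Pt n) 0ℓ
        Opposite s = T s × det d₀ (u s) ≡ 0ℤ × d₀ · u s < 0ℤ
        Left s = T s × 0ℤ < det d₀ (u s)
        Right s = T s × det d₀ (u s) < 0ℤ

        Opposite? : Decidable Opposite
        Opposite? s = T? s ×-dec (det d₀ (u s) ℤ.≟ 0ℤ ×-dec d₀ · u s ℤP.<? 0ℤ)

        Left? : Decidable Left
        Left? s = T? s ×-dec (0ℤ ℤP.<? det d₀ (u s))

        Right? : Decidable Right
        Right? s = T? s ×-dec (det d₀ (u s) ℤP.<? 0ℤ)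

        opposite⇒InHull : ∀ {s} → Opposite s → InHull n T x
        opposite⇒InHull {s} (Ts , d₀us≡0 , d₀·us<0) = barycentric⇒InHull {x = x} T₀ Ts Ts
          (barycentric (u s · u s) (- (d₀ · u s)) 0ℤ (ℤP.<⇒≤ 0<us·us) (ℤP.<⇒≤ 0<-d₀·us) ℤP.≤-refl
            (ℤP.+-mono-<-≤ (ℤP.+-mono-< 0<us·us 0<-d₀·us) ℤP.≤-refl)
            (trans (segment-⊛ d₀ (u s)) (cong (_⊛ perp (u s)) (trans (det-antisym d₀ (u s)) (cong -_ d₀us≡0)))))
          where
          0<us·us : 0ℤ < u s · u s
          0<us·us = d≢0²⇒0<d·d (≢⇒⊖≢0² (x∉T Ts))
          0<-d₀·us : 0ℤ < - (d₀ · u s)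
          0<-d₀·us = ℤP.neg-mono-< d₀·us<0

        on-ray : (∀ {s} → ¬ Opposite s) → ∀ {s} → T s → det d₀ (u s) ≡ 0ℤ → 0ℤ < d₀ · u s
        on-ray ∄opposite {s} Ts d₀us≡0 with ℤP.<-cmp (d₀ · u s) 0ℤ
        ... | tri< d₀·us<0 _ _ = contradiction (Ts , d₀us≡0 , d₀·us<0) ∄opposite
        ... | tri≈ _ d₀·us≡0 _ = contradiction (·≡0∧det≡0⇒≡0² d₀≢0² d₀·us≡0 d₀us≡0) (≢⇒⊖≢0² (x∉T Ts))
        ... | tri> _ _ 0<d₀·us = 0<d₀·us

        record LeftExtreme : Set where
          field
            a       : Pt n
            T-a     : T a
            0≤d₀a   : 0ℤ ≤ det d₀ (u a)
            maximal : ∀ {s} → Left s → 0ℤ ≤ det (u s) (u a)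
            strict  : ∃ Left → 0ℤ < det d₀ (u a)

        record RightExtreme : Set where
          field
            b       : Pt n
            T-b     : T b
            d₀b≤0   : det d₀ (u b) ≤ 0ℤ
            minimal : ∀ {s} → Right s → 0ℤ ≤ det (u b) (u s)
            strict  : ∃ Right → det d₀ (u b) < 0ℤ

        left-extreme : LeftExtreme
        left-extreme with any?ₚ Left?
        ... | no ∄left = record
          { a = s₀ ; T-a = T₀ ; 0≤d₀a = ℤP.≤-reflexive (sym (det-self d₀))
          ; maximal = λ Ls → contradiction (_ , Ls) ∄left ; strict = λ ∃left → contradiction ∃left ∄left }
        ... | yes (_ , L₀) = let m , Lm , max = angular-max Left? u (perp d₀) proj₂ L₀ in record
          { a = m ; T-a = proj₁ Lm ; 0≤d₀a = ℤP.<⇒≤ (proj₂ Lm) ; maximal = max ; strict = λ _ → proj₂ Lm }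

        right-extreme : RightExtreme
        right-extreme with any?ₚ Right?
        ... | no ∄right = record
          { b = s₀ ; T-b = T₀ ; d₀b≤0 = ℤP.≤-reflexive (det-self d₀)
          ; minimal = λ Rs → contradiction (_ , Rs) ∄right ; strict = λ ∃right → contradiction ∃right ∄right }
        ... | yes (_ , R₀) = let m , Rm , min = angular-min Right? u (⊝ perp d₀) in-front R₀ in record
          { b = m ; T-b = proj₁ Rm ; d₀b≤0 = ℤP.<⇒≤ (proj₂ Rm) ; minimal = min ; strict = λ _ → proj₂ Rm }
          where
          in-front : ∀ {s} → Right s → 0ℤ < (⊝ perp d₀) · u s
          in-front {s} (_ , d₀us<0) = subst (0ℤ <_) (sym (·-⊝ (perp d₀) (u s))) (ℤP.neg-mono-< d₀us<0)

        module _ (∄opposite : ∀ {s} → ¬ Opposite s) (some-side : ∃ Left ⊎ ∃ Right) where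
          open LeftExtreme left-extreme
          open RightExtreme right-extreme renaming (strict to strictʳ)

          one-strict : 0ℤ < det d₀ (u a) ⊎ 0ℤ < det (u b) d₀
          one-strict = Sum.map strict (λ ∃right → det-flip-> {d₀} {u b} (strictʳ ∃right)) some-side

          0<ba-sum : ∀ {l} → 0ℤ ≤ l → 0ℤ < det d₀ (u a) + l + det (u b) d₀
          0<ba-sum 0≤l = Sum.[ (λ 0<d₀a → ℤP.+-mono-<-≤ (ℤP.+-mono-<-≤ 0<d₀a 0≤l) (det-flip-≤ {d₀} {u b} d₀b≤0))
                             , (λ 0<bd₀ → ℤP.+-mono-≤-< (ℤP.+-mono-≤ 0≤d₀a 0≤l) 0<bd₀) ]′ one-strict

          between : 0ℤ < det (u b) (u a) → ∀ {s} → T s → 0ℤ < det (u b) (u s) + det (u s) (u a)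
          between 0<ba {s} Ts = by-side (ℤP.<-cmp 0ℤ (det d₀ (u s)))
            where
            by-side : Tri (0ℤ < det d₀ (u s)) (0ℤ ≡ det d₀ (u s)) (det d₀ (u s) < 0ℤ) →
                      0ℤ < det (u b) (u s) + det (u s) (u a)
            by-side (tri< 0<d₀s _ _) = ℤP.+-mono-<-≤ 0<bs (maximal (Ts , 0<d₀s))
              where
              0<bs : 0ℤ < det (u b) (u s)
              0<bs = 0<i*j∧0<j⇒0<i
                (x+y+z≡0⇒0<z (jacobi (perp d₀) (u b) (u s) (u a)) (0≤i∧j≤0⇒i*j≤0 (maximal (Ts , 0<d₀s)) d₀b≤0)
                                                                   (i<0∧0<j⇒i*j<0 (det-flip-< {u b} {u a} 0<ba) 0<d₀s))
                (strict (s , Ts , 0<d₀s))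
            by-side (tri> _ _ d₀s<0) = ℤP.+-mono-≤-< (minimal (Ts , d₀s<0)) 0<sa
              where
              0<sa : 0ℤ < det (u s) (u a)
              0<sa = i*j<0∧j<0⇒0<i
                (x+y+z≡0⇒x<0 (jacobi (perp d₀) (u b) (u s) (u a)) (i<0∧j<0⇒0<i*j (det-flip-< {u b} {u a} 0<ba) d₀s<0)
                                                                   (0≤i*j (minimal (Ts , d₀s<0)) 0≤d₀a))
                (strictʳ (s , Ts , d₀s<0))
            by-side (tri≈ _ 0≡d₀s _) = 0<i∧0<i*j⇒0<j (d≢0²⇒0<d·d d₀≢0²) (begin-strict
              0ℤ                                                    <⟨ 0<i*j (on-ray ∄opposite Ts (sym 0≡d₀s)) 0<sum ⟩
              d₀ · u s * (det (u b) d₀ + det d₀ (u a))              ≡⟨ ℤP.+-identityʳ _ ⟨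
              d₀ · u s * (det (u b) d₀ + det d₀ (u a)) + 0ℤ         ≡⟨ cong (λ t → d₀ · u s * (det (u b) d₀ + det d₀ (u a)) + t * (u b · d₀ - d₀ · u a)) 0≡d₀s ⟩
              d₀ · u s * (det (u b) d₀ + det d₀ (u a)) + det d₀ (u s) * (u b · d₀ - d₀ · u a) ≡⟨ ray-det d₀ (u s) (u a) (u b) ⟨
              d₀ · d₀ * (det (u b) (u s) + det (u s) (u a))         ∎)
              where
              open ℤP.≤-Reasoning
              0<sum : 0ℤ < det (u b) d₀ + det d₀ (u a)
              0<sum = Sum.[ (λ 0<d₀a → ℤP.+-mono-≤-< (det-flip-≤ {d₀} {u b} d₀b≤0) 0<d₀a)
                          , (λ 0<bd₀ → ℤP.+-mono-<-≤ 0<bd₀ 0≤d₀a) ]′ one-strict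

          separate-two-sided : InHull n T x ⊎ Separated T x
          separate-two-sided = by-angle (0ℤ ℤP.<? det (u b) (u a))
            where
            by-angle : Dec (0ℤ < det (u b) (u a)) → InHull n T x ⊎ Separated T x
            by-angle (yes 0<ba) = inj₂ (separated-by (perp (u a ⊖ u b)) λ {s} Ts →
                    subst (_< 0ℤ) (sym (det-⊖ (u a) (u b) (u s))) (ℤP.neg-mono-< (between 0<ba Ts)))
            by-angle (no 0≮ba) = inj₁ (barycentric⇒InHull {x = x} T-b T₀ T-a
                  (barycentric (det d₀ (u a)) (det (u a) (u b)) (det (u b) d₀) 0≤d₀a 0≤ab (det-flip-≤ {d₀} {u b} d₀b≤0)
                               (0<ba-sum 0≤ab) (jacobi-⊛ (u b) d₀ (u a))))
              where
              0≤ab : 0ℤ ≤ det (u a) (u b)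
              0≤ab = det-flip-≤ {u b} {u a} (ℤP.≮⇒≥ 0≮ba)

      -- Sweep around x from the direction d₀ of s₀: either a point lies opposite to d₀ (x is on a segment), or the
      -- extreme directions a and b to the left and to the right of d₀ span an angle below π (a line through x
      -- separates), or x lies in the triangle b s₀ a.
      separate-around : InHull n T x ⊎ Separated T x
      separate-around with any?ₚ Opposite? | any?ₚ Left? | any?ₚ Right?
      ... | yes (_ , opposite) | _ | _ = inj₁ (opposite⇒InHull opposite)
      ... | no ∄opposite | yes ∃left | _ = separate-two-sided (λ opp → ∄opposite (_ , opp)) (inj₁ ∃left)
      ... | no ∄opposite | _ | yes ∃right = separate-two-sided (λ opp → ∄opposite (_ , opp)) (inj₂ ∃right)
      ... | no ∄opposite | no ∄left | no ∄right = inj₂ (separated-by (⊝ d₀) λ {s} Ts →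
            subst (_< 0ℤ) (sym (·-⊝ d₀ (u s))) (ℤP.neg-mono-< (on-ray (λ opp → ∄opposite (_ , opp)) Ts (on-line Ts))))
        where
        on-line : ∀ {s} → T s → det d₀ (u s) ≡ 0ℤ
        on-line {s} Ts with ℤP.<-cmp 0ℤ (det d₀ (u s))
        ... | tri< 0<d₀s _ _ = contradiction (s , Ts , 0<d₀s) ∄left
        ... | tri≈ _ 0≡d₀s _ = sym 0≡d₀s
        ... | tri> _ _ d₀s<0 = contradiction (s , Ts , d₀s<0) ∄right

    separate : InHull n T x ⊎ Separated T x
    separate with any?ₚ T?
    ... | yes (_ , T₀) = separate-around T₀
    ... | no ∄T = inj₂ (0² , λ {s} Ts → contradiction (s , Ts) ∄T)

module Convexity where

  open Signs
  open Plane
  open Grid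
  open Hull
  open Separation
  open import Data.Nat as ℕ using (ℕ)
  open import Data.Integer as ℤ using (ℤ; 0ℤ; _≤_; _<_)
  import Data.Integer.Properties as ℤP
  open import Data.Rational as ℚ using (ℚ)
  open import Data.Bool using (true; false; not; if_then_else_)
  import Data.Bool.Properties as BoolP
  open import Data.Fin as Fin using (Fin)
  import Data.Fin.Properties as FinP
  open import Data.Product using (Σ; _×_; _,_; proj₁; proj₂)
  open import Data.Sum using (_⊎_; inj₁; inj₂)
  open import Function.Bundles using (mk⇔; Equivalence)
  open import Relation.Nullary using (does; yes; no)
  open import Relation.Nullary.Negation using (contradiction)
  open import Relation.Binary.PropositionalEquality
  open Equivalence

  private variable n : ℕ

  LatticeConvex : ∀ n → BoolFun n → Set
  LatticeConvex n g = ∀ y → InP n g y → g y ≡ true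

  InT⇒latticeConvex : ∀ {g : BoolFun n} → InT n g → LatticeConvex n g
  InT⇒latticeConvex (_ , a₁ , a₂ , a₀ , system) y y∈P =
    from (system y) λ i → InConv-≤ (a₁ i) (a₂ i) (a₀ i) (λ p gp → to (system p) gp i) y∈P

  record Cut (S : Pt n → Set) (y : Pt n) : Set where
    field
      normal : ℤ²
      bound  : ℤ
      keeps  : ∀ {s} → S s → normal · vec s ≤ bound
      cuts   : bound < normal · vec y

  separated⇒cut : ∀ {S : Pt n → Set} {y} → Separated S y → Cut S y
  separated⇒cut {y = y} (c , below) = record
    { normal = c ; bound = ℤ.pred (c · vec y)
    ; keeps = λ Ss → ℤP.i<j⇒i≤pred[j] (below Ss) ; cuts = ℤP.i≤pred[j]⇒i<j ℤP.≤-refl }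

  Cut-⊆ : ∀ {S S′ : Pt n → Set} {y} → (∀ {s} → S s → S′ s) → Cut S′ y → Cut S y
  Cut-⊆ S⊆S′ cut = record { Cut cut ; keeps = λ Ss → Cut.keeps cut (S⊆S′ Ss) }

  cuts⇒InT : ∀ {g : BoolFun n} → (∀ y → M₀ g y → Cut (M₁ g) y) → InT n g
  cuts⇒InT {n} {g} cut = n ℕ.* n , a₁ , a₂ , a₀ , λ z → mk⇔ (keeps-all z) (kept⇒M₁ z)
    where
    plane : ∀ y → Σ ℤ² λ c → Σ ℤ λ b → (∀ {z} → M₁ g z → c · vec z ≤ b) × (M₀ g y → b < c · vec y)
    plane y with g y in gy
    ... | true  = 0² , 0ℤ , (λ _ → ℤP.≤-refl) , λ ()
    ... | false = let open Cut (cut y gy) in normal , bound , keeps , λ _ → cuts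
    normal : Pt n → ℤ²
    normal y = proj₁ (plane y)
    bound : Pt n → ℤ
    bound y = proj₁ (proj₂ (plane y))
    y : Fin (n ℕ.* n) → Pt n
    y = Fin.remQuot n
    a₁ a₂ a₀ : Fin (n ℕ.* n) → ℚ
    a₁ i = ι (proj₁ (normal (y i)))
    a₂ i = ι (proj₂ (normal (y i)))
    a₀ i = ι (bound (y i))
    Kept : Pt n → Fin (n ℕ.* n) → Set
    Kept z i = a₁ i ℚ.* qc (proj₁ z) ℚ.+ a₂ i ℚ.* qc (proj₂ z) ℚ.≤ a₀ i
    kept⇒≤ : ∀ z i → Kept z i → normal (y i) · vec z ≤ bound (y i)
    kept⇒≤ z i kept = ι-cancel-≤ (subst (ℚ._≤ a₀ i) (ι-· (normal (y i)) z) kept)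
    keeps-all : ∀ z → M₁ g z → ∀ i → Kept z i
    keeps-all z gz i = subst (ℚ._≤ a₀ i) (sym (ι-· (normal (y i)) z)) (ι-mono-≤ (proj₁ (proj₂ (proj₂ (plane (y i)))) gz))
    kept⇒M₁ : ∀ z → (∀ i → Kept z i) → M₁ g z
    kept⇒M₁ z kept with g z in gz
    ... | true  = refl
    ... | false = contradiction (kept⇒≤ z i (kept i))
                    (ℤP.<⇒≱ (subst (λ w → bound w < normal w · vec z) (sym y-i≡z) (proj₂ (proj₂ (proj₂ (plane z))) gz)))
      where
      i : Fin (n ℕ.* n)
      i = Fin.combine (proj₁ z) (proj₂ z)
      y-i≡z : y i ≡ z
      y-i≡z = FinP.remQuot-combine (proj₁ z) (proj₂ z)

  latticeConvex⇒InT : ∀ {g : BoolFun n} → LatticeConvex n g → InT n g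
  latticeConvex⇒InT {n} {g} convex = cuts⇒InT cut
    where
    cut : ∀ y → M₀ g y → Cut (M₁ g) y
    cut y gy≡false = from-separation (separate (λ s → g s BoolP.≟ true) y∉M₁)
      where
      y∉M₁ : ∀ {s} → M₁ g s → s ≢ y
      y∉M₁ gs refl = contradiction (trans (sym gs) gy≡false) λ ()
      from-separation : InP n g y ⊎ Separated (M₁ g) y → Cut (M₁ g) y
      from-separation (inj₁ y∈P) = contradiction (trans (sym (convex y y∈P)) gy≡false) λ ()
      from-separation (inj₂ separated) = separated⇒cut separated

  flip-at : BoolFun n → Pt n → BoolFun n
  flip-at f x z = if does (z ≟ₚ x) then not (f z) else f z

  flip-at-here : ∀ (f : BoolFun n) x → flip-at f x x ≡ not (f x)
  flip-at-here f x with x ≟ₚ x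
  ... | yes _   = refl
  ... | no x≢x = contradiction refl x≢x

  flip-at-elsewhere : ∀ (f : BoolFun n) {x z} → z ≢ x → flip-at f x z ≡ f z
  flip-at-elsewhere f {x} {z} z≢x with z ≟ₚ x
  ... | yes z≡x = contradiction z≡x z≢x
  ... | no _    = refl

  M₁-flip-at⊆ : ∀ (f : BoolFun n) x {s} → M₁ (flip-at f x) s → M₁ f s ⊎ s ≡ x
  M₁-flip-at⊆ f x {s} gs with s ≟ₚ x
  ... | yes s≡x = inj₂ s≡x
  ... | no _    = inj₁ gs

  InT-flip-at⇒essential : ∀ {f : BoolFun n} {x} → InT n (flip-at f x) → Essential n f x
  InT-flip-at⇒essential {f = f} {x} T-flip =
    flip-at f x , T-flip , (λ e → BoolP.not-¬ refl (sym (trans (sym (flip-at-here f x)) e))) , λ z → flip-at-elsewhere f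

module Edges where

  open Signs
  open Plane
  open Grid
  open import Data.Nat as ℕ using (ℕ; suc)
  import Data.Nat.Properties as ℕP
  import Data.Nat.DivMod as ℕDivMod
  open import Data.Nat.Divisibility as ℕDiv using ()
  open import Data.Nat.GCD using (gcd; gcd[m,n]∣m; gcd[m,n]∣n; gcd[m,n]≢0)
  open import Data.Nat.Coprimality using (Coprime; coprime-/gcd)
  open import Data.Integer as ℤ using (ℤ; +_; -[1+_]; 0ℤ; 1ℤ; _+_; _*_; _-_; -_; _≤_; _<_; ∣_∣)
  import Data.Integer.Properties as ℤP
  open import Data.Product using (Σ; ∃; _×_; _,_; proj₁; proj₂)
  open import Data.Sum as Sum using ()
  open import Relation.Nullary using (¬_; ¬?; Dec; yes; no)
  open import Relation.Nullary.Decidable using (_×-dec_; decidable-stable)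
  open import Relation.Binary.Definitions using (Tri; tri<; tri≈; tri>)
  open import Relation.Unary using (Pred; Decidable)
  open import Level using (0ℓ)
  open import Function using (_∘_)
  open import Data.Bool as Bool using (true)
  open import Data.Integer.Tactic.RingSolver using (solve-∀)
  open import Relation.Nullary.Negation using (contradiction)
  open import Relation.Binary.PropositionalEquality

  private variable n : ℕ

  divide : ∀ i (g : ℕ) .{{_ : ℕ.NonZero g}} → g ℕDiv.∣ ∣ i ∣ → Σ ℤ λ a → i ≡ + g * a × ∣ a ∣ ≡ ∣ i ∣ ℕ./ g
  divide (+ m) g g∣m = + (m ℕ./ g) , trans (cong +_ (sym (ℕDivMod.m*[n/m]≡n g∣m))) (ℤP.pos-* g (m ℕ./ g)) , refl
  divide -[1+ m ] g g∣m = - (+ (suc m ℕ./ g)) ,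
    trans (cong (λ k → - (+ k)) (sym (ℕDivMod.m*[n/m]≡n g∣m)))
          (trans (cong -_ (ℤP.pos-* g (suc m ℕ./ g))) (ℤP.neg-distribʳ-* (+ g) (+ (suc m ℕ./ g)))) ,
    ℤP.∣-i∣≡∣i∣ (+ (suc m ℕ./ g))

  primitive-part : ∀ {N} → N ≢ 0² → Σ ℤ λ k → Σ ℤ² λ a → 0ℤ < k × Coprime ∣ proj₁ a ∣ ∣ proj₂ a ∣ × N ≡ k ⊛ a
  primitive-part {N₁ , N₂} N≢0 =
    let a₁ , N₁≡ga₁ , ∣a₁∣≡ = divide N₁ g (gcd[m,n]∣m ∣ N₁ ∣ ∣ N₂ ∣)
        a₂ , N₂≡ga₂ , ∣a₂∣≡ = divide N₂ g (gcd[m,n]∣n ∣ N₁ ∣ ∣ N₂ ∣)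
    in + g , (a₁ , a₂) , ℤ.+<+ (ℕP.n≢0⇒n>0 g≢0) ,
       subst₂ Coprime (sym ∣a₁∣≡) (sym ∣a₂∣≡) (coprime-/gcd ∣ N₁ ∣ ∣ N₂ ∣) , cong₂ _,_ N₁≡ga₁ N₂≡ga₂
    where
    g : ℕ
    g = gcd ∣ N₁ ∣ ∣ N₂ ∣
    g≢0 : g ≢ 0
    g≢0 = gcd[m,n]≢0 ∣ N₁ ∣ ∣ N₂ ∣ (Sum.map (λ N₁≢0 → N₁≢0 ∘ ℤP.∣i∣≡0⇒i≡0) (λ N₂≢0 → N₂≢0 ∘ ℤP.∣i∣≡0⇒i≡0) (≢0²⇒≢0⊎≢0 N≢0))
    instance
      g-nonZero : ℕ.NonZero g
      g-nonZero = ℕ.≢-nonZero g≢0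

  EdgeBeyond : ∀ n → BoolFun n → Pt n → Set
  EdgeBeyond n f y = Σ ℤ λ a₁ → Σ ℤ λ a₂ → Σ ℤ λ a₀ → IsEdgeLine n f a₁ a₂ a₀ × a₀ < lin a₁ a₂ y

  supporting⇒edge : ∀ {f : BoolFun n} {p q y} N → M₁ f p → M₁ f q → p ≢ q →
                    (∀ {s} → M₁ f s → N · (vec s ⊖ vec p) ≤ 0ℤ) → N · (vec q ⊖ vec p) ≡ 0ℤ →
                    0ℤ < N · (vec y ⊖ vec p) → EdgeBeyond n f y
  supporting⇒edge {n} {f} {p} {q} {y} N fp fq p≢q below on-line beyond
    with primitive-part {N} (λ N≡0 → ℤP.<-irrefl refl (subst (λ M → 0ℤ < M · (vec y ⊖ vec p)) N≡0 beyond))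
  ... | k , a@(a₁ , a₂) , 0<k , coprime , refl =
    a₁ , a₂ , a · vec p ,
    (coprime , (λ s fs → ℤP.i-j≤0⇒i≤j (relative (_≤ 0ℤ) s (0<i∧i*j≤0⇒j≤0 0<k (scaled (_≤ 0ℤ) s (below fs))))) ,
     p , q , p≢q , fp , fq , refl ,
     ℤP.i-j≡0⇒i≡j _ _ (relative (_≡ 0ℤ) q (0<i∧i*j≡0⇒j≡0 0<k (scaled (_≡ 0ℤ) q on-line)))) ,
    0<i-j⇒j<i (relative (0ℤ <_) y (0<i∧0<i*j⇒0<j 0<k (scaled (0ℤ <_) y beyond)))
    where
    scaled : ∀ (R : ℤ → Set) (z : Pt n) → R ((k ⊛ a) · (vec z ⊖ vec p)) → R (k * (a · (vec z ⊖ vec p)))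
    scaled R z = subst R (·-⊛ k a (vec z ⊖ vec p))
    relative : ∀ (R : ℤ → Set) (z : Pt n) → R (a · (vec z ⊖ vec p)) → R (a · vec z - a · vec p)
    relative R z = subst R (·-⊖ a (vec z) (vec p))

  collinear⇒¬area : ∀ {f : BoolFun n} {d} {p : Pt n} → d ≢ 0² → (∀ {s} → M₁ f s → det d (vec s) ≡ det d (vec p)) → ¬ PositiveArea n f
  collinear⇒¬area {n} {f} {d} {p} d≢0 collinear (P , Q , R , fP , fQ , fR , area) =
    area (det≡0⇒cross-equal (vec Q ⊖ vec P) (vec R ⊖ vec P) (det≡0∧det≡0⇒det≡0 d≢0 (on-line fQ) (on-line fR)))
    where
    on-line : ∀ {s} → M₁ f s → det d (vec s ⊖ vec P) ≡ 0ℤ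
    on-line {s} fs = trans (·-⊖ (perp d) (vec s) (vec P)) (ℤP.i≡j⇒i-j≡0 (trans (collinear fs) (sym (collinear fP))))

  module _ {f : BoolFun n} (area : PositiveArea n f) {y : Pt n} {c : ℤ²}
           (c-separates : ∀ {s} → M₁ f s → c · vec s < c · vec y) where

    private
      M₁? : Decidable (M₁ f)
      M₁? s = f s Bool.≟ true

      c≢0² : c ≢ 0²
      c≢0² c≡0 = let _ , _ , _ , fP , _ = area in
        ℤP.<-irrefl refl (subst (λ c → c · vec _ < c · vec y) c≡0 (c-separates fP))

      det-c : Pt n → ℤ
      det-c s = det c (vec s)

      -- φ refines the order given by c, breaking ties along perp c; B bounds the tie-breaking term on the grid.
      module Perturbed (B : ℤ) (spread : ∀ s t → det-c s - det-c t ≤ B) where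
        φ : ℤ²
        φ = (B + 1ℤ) ⊛ c ⊕ perp c

        φ-refines : ∀ {s t} → c · vec s < c · vec t → φ · vec s < φ · vec t
        φ-refines {s} {t} cs<ct = 0<i-j⇒j<i (subst (0ℤ <_) (·-⊖ φ (vec t) (vec s)) (begin-strict
          0ℤ                                          <⟨ ℤP.+-mono-≤-< (ℤP.+-mono-≤ (0≤i*j 0≤B+1 0≤D-1) 0≤E+B) (ℤ.+<+ ℕ.z<s) ⟩
          (B + 1ℤ) * (D - 1ℤ) + (E + B) + 1ℤ          ≡⟨ ring B D E ⟨
          (B + 1ℤ) * D + E                            ≡⟨ ·-⊛⊕ (B + 1ℤ) c (perp c) v ⟨
          φ · v                                       ∎))
          where
          open ℤP.≤-Reasoning
          v : ℤ²
          v = vec t ⊖ vec s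
          D E : ℤ
          D = c · v
          E = det c v
          ring : ∀ B D E → (B + 1ℤ) * D + E ≡ (B + 1ℤ) * (D - 1ℤ) + (E + B) + 1ℤ
          ring = solve-∀
          0≤B+1 : 0ℤ ≤ B + 1ℤ
          0≤B+1 = ℤP.≤-trans (subst (_≤ B) (ℤP.+-inverseʳ (det c (vec t))) (spread t t)) (ℤP.i≤i+j B 1ℤ)
          0≤D-1 : 0ℤ ≤ D - 1ℤ
          0≤D-1 = ℤP.i≤j⇒0≤j-i (ℤP.i<j⇒suc[i]≤j (subst (0ℤ <_) (sym (·-⊖ c (vec t) (vec s))) (i<j⇒0<j-i cs<ct)))
          0≤E+B : 0ℤ ≤ E + B
          0≤E+B = subst (0ℤ ≤_) (sym (trans (cong (_+ B) (·-⊖ (perp c) (vec t) (vec s))) (ring′ (det c (vec t)) (det c (vec s)) B)))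
                                (ℤP.i≤j⇒0≤j-i (spread s t))
            where
            ring′ : ∀ x y B → x - y + B ≡ B - (y - x)
            ring′ = solve-∀

        φ-injective : ∀ {s t} → φ · vec s ≡ φ · vec t → s ≡ t
        φ-injective {s} {t} φs≡φt = by-c (ℤP.<-cmp (c · vec s) (c · vec t))
          where
          v : ℤ²
          v = vec s ⊖ vec t
          by-c : Tri (c · vec s < c · vec t) (c · vec s ≡ c · vec t) (c · vec t < c · vec s) → s ≡ t
          by-c (tri< cs<ct _ _) = contradiction φs≡φt (ℤP.<⇒≢ (φ-refines cs<ct))
          by-c (tri> _ _ ct<cs) = contradiction (sym φs≡φt) (ℤP.<⇒≢ (φ-refines ct<cs))
          by-c (tri≈ _ cs≡ct _) = ⊖≡0²⇒≡ (·≡0∧det≡0⇒≡0² c≢0² c·v≡0 (begin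
            det c v                            ≡⟨ ℤP.+-identityˡ (det c v) ⟨
            0ℤ + det c v                       ≡⟨ cong (_+ det c v) (trans (cong ((B + 1ℤ) *_) c·v≡0) (ℤP.*-zeroʳ (B + 1ℤ))) ⟨
            (B + 1ℤ) * (c · v) + det c v       ≡⟨ ·-⊛⊕ (B + 1ℤ) c (perp c) v ⟨
            φ · v                              ≡⟨ ·-⊖ φ (vec s) (vec t) ⟩
            φ · vec s - φ · vec t              ≡⟨ ℤP.i≡j⇒i-j≡0 φs≡φt ⟩
            0ℤ                                 ∎))
            where
            open ≡-Reasoning
            c·v≡0 : c · v ≡ 0ℤ
            c·v≡0 = trans (·-⊖ c (vec s) (vec t)) (ℤP.i≡j⇒i-j≡0 cs≡ct)

        module Top {p} (fp : M₁ f p) (p-max : ∀ {s} → M₁ f s → φ · vec s ≤ φ · vec p) where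

          below-top : ∀ {s} → M₁ f s → s ≢ p → φ · vec s < φ · vec p
          below-top fs s≢p = ℤP.≤∧≢⇒< (p-max fs) (λ φs≡φp → s≢p (φ-injective φs≡φp))

          W : Pred (Pt n) 0ℓ
          W s = M₁ f s × s ≢ p

          W? : Decidable W
          W? s = M₁? s ×-dec ¬? (s ≟ₚ p)

          w : Pt n → ℤ²
          w s = vec s ⊖ vec p

          ψ : ℤ²
          ψ = ⊝ φ

          ψ·w : ∀ s → ψ · w s ≡ - (φ · vec s - φ · vec p)
          ψ·w s = trans (·-⊝ φ (w s)) (cong -_ (·-⊖ φ (vec s) (vec p)))

          in-front : ∀ {s} → W s → 0ℤ < ψ · w s
          in-front {s} (fs , s≢p) = subst (0ℤ <_) (sym (ψ·w s)) (ℤP.neg-mono-< (i<j⇒i-j<0 (below-top fs s≢p)))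

          y-behind : ψ · w y < 0ℤ
          y-behind = subst (_< 0ℤ) (sym (ψ·w y)) (ℤP.neg-mono-< (i<j⇒0<j-i (φ-refines (c-separates fp))))

          module _ {qM qm} (WqM : W qM) (Wqm : W qm)
                   (qM-max : ∀ {s} → W s → 0ℤ ≤ det (w s) (w qM)) (qm-min : ∀ {s} → W s → 0ℤ ≤ det (w qm) (w s)) where

            flat : det (w qM) (w y) ≤ 0ℤ → 0ℤ ≤ det (w qm) (w y) → ∀ {s} → W s → det (w qM) (w s) ≡ 0ℤ
            flat qMy≤0 0≤qmy {s} Ws = i*j≡0∧j≢0⇒i≡0
              (x+y+z≡0⇒x≡0 (jacobi ψ (w qm) (w qM) (w s))
                (i≤0∧0<j⇒i*j≤0 (det-flip-≥ {w s} {w qM} (qM-max Ws)) (in-front Wqm))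
                (i≤0∧0<j⇒i*j≤0 (det-flip-≥ {w qm} {w s} (qm-min Ws)) (in-front WqM))
                (ℤP.≤-reflexive (cong (_* (ψ · w s)) qmqM≡0)))
              (ℤP.<⇒≢ (in-front Wqm) ∘ sym)
              where
              qmqM≡0 : det (w qm) (w qM) ≡ 0ℤ
              qmqM≡0 = i*j≡0∧j≢0⇒i≡0
                (x+y+z≡0⇒z≡0 (jacobi ψ (w qm) (w qM) (w y))
                  (i≤0∧0<j⇒i*j≤0 qMy≤0 (in-front Wqm))
                  (i≤0∧0<j⇒i*j≤0 (det-flip-≥ {w qm} {w y} 0≤qmy) (in-front WqM))
                  (0≤i∧j≤0⇒i*j≤0 (qm-min WqM) (ℤP.<⇒≤ y-behind)))
                (ℤP.<⇒≢ y-behind)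

            supporting-at : ∀ N → (∀ {s} → W s → N · w s ≤ 0ℤ) → ∀ {s} → M₁ f s → N · w s ≤ 0ℤ
            supporting-at N below {s} fs with s ≟ₚ p
            ... | yes refl = ℤP.≤-reflexive (·-⊖-self N (vec p))
            ... | no s≢p   = below (fs , s≢p)

            -- Seen from the unique φ-maximal point p, the angular extremes qM, qm of the other points are the
            -- neighbours of p on the hull; y lies beyond one of the two edges p qM, p qm unless M₁ f is collinear.
            edge-from-extremes : Dec (0ℤ < det (w qM) (w y)) → Dec (det (w qm) (w y) < 0ℤ) → EdgeBeyond n f y
            edge-from-extremes (yes 0<qMy) _ =
              supporting⇒edge (perp (w qM)) fp (proj₁ WqM) (proj₂ WqM ∘ sym)
                (supporting-at (perp (w qM)) (λ {s} Ws → det-flip-≥ {w s} {w qM} (qM-max Ws))) (det-self (w qM)) 0<qMy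
            edge-from-extremes _ (yes qmy<0) =
              supporting⇒edge (⊝ perp (w qm)) fp (proj₁ Wqm) (proj₂ Wqm ∘ sym)
                (supporting-at (⊝ perp (w qm)) (λ {s} Ws → subst (_≤ 0ℤ) (sym (·-⊝ (perp (w qm)) (w s))) (ℤP.neg-mono-≤ (qm-min Ws))))
                (trans (·-⊝ (perp (w qm)) (w qm)) (cong -_ (det-self (w qm))))
                (subst (0ℤ <_) (sym (·-⊝ (perp (w qm)) (w y))) (ℤP.neg-mono-< qmy<0))
            edge-from-extremes (no 0≮qMy) (no qmy≮0) = contradiction area (collinear⇒¬area (≢⇒⊖≢0² (proj₂ WqM)) on-line)
              where
              on-line : ∀ {s} → M₁ f s → det (w qM) (vec s) ≡ det (w qM) (vec p)
              on-line {s} fs with s ≟ₚ p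
              ... | yes refl = refl
              ... | no s≢p   = ℤP.i-j≡0⇒i≡j _ _ (trans (sym (·-⊖ (perp (w qM)) (vec s) (vec p)))
                                 (flat (ℤP.≮⇒≥ 0≮qMy) (ℤP.≮⇒≥ qmy≮0) (fs , s≢p)))

          edge-from-top : EdgeBeyond n f y
          edge-from-top = from-W (any?ₚ W?)
            where
            from-W : Dec (∃ W) → EdgeBeyond n f y
            from-W (yes (_ , W₀)) =
              let qM , WqM , qM-max = angular-max W? w ψ in-front W₀
                  qm , Wqm , qm-min = angular-min W? w ψ in-front W₀
              in edge-from-extremes WqM Wqm qM-max qm-min (0ℤ ℤP.<? det (w qM) (w y)) (det (w qm) (w y) ℤP.<? 0ℤ)
            from-W (no ∄W) = contradiction area (collinear⇒¬area c≢0² λ {s} fs →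
              cong det-c (decidable-stable (s ≟ₚ p) (λ s≢p → ∄W (s , fs , s≢p))))

    edge-beyond : EdgeBeyond n f y
    edge-beyond =
      let B , spread = bounded-difference det-c
          _ , _ , _ , fP , _ = area
          open Perturbed B spread
          p , fp , p-max = maximum M₁? (λ {s} {t} _ _ → ℤP.≤-total (φ · vec s) (φ · vec t)) (λ _ _ _ → ℤP.≤-trans) fP
      in Top.edge-from-top fp p-max

module LatticePoints where

  open Signs
  open Plane
  open Grid
  open Hull
  open import Data.Nat as ℕ using (ℕ)
  open import Data.Nat.GCD using (module Bézout)
  open import Data.Nat.Coprimality using (Coprime; coprime-Bézout)
  open import Data.Integer as ℤ using (ℤ; +_; -[1+_]; 0ℤ; 1ℤ; -1ℤ; _+_; _*_; _-_; -_; _≤_; _<_; ∣_∣)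
  import Data.Integer.Properties as ℤP
  open import Data.Integer.DivMod using (_/ℕ_; _%ℕ_; a≡a%ℕn+[a/ℕn]*n; n%ℕd<d)
  open import Data.Integer.Tactic.RingSolver using (solve-∀)
  open import Data.Product using (Σ; _×_; _,_; proj₁; proj₂)
  open import Relation.Binary.Definitions using (Tri; tri<; tri≈; tri>)
  open import Relation.Nullary.Negation using (contradiction)
  open import Relation.Binary.PropositionalEquality

  private variable n : ℕ

  sign-unit : ∀ a → Σ ℤ λ s → + ∣ a ∣ ≡ s * a
  sign-unit (+ m)    = 1ℤ , sym (ℤP.*-identityˡ (+ m))
  sign-unit -[1+ m ] = -1ℤ , sym (ℤP.-1*i≡-i -[1+ m ])

  bézout-identity : ∀ a₁ a₂ x y → 1 ℕ.+ y ℕ.* ∣ a₂ ∣ ≡ x ℕ.* ∣ a₁ ∣ → Σ ℤ² λ e → (a₁ , a₂) · e ≡ 1ℤ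
  bézout-identity a₁ a₂ x y eq =
    let s₁ , ∣a₁∣≡s₁a₁ = sign-unit a₁
        s₂ , ∣a₂∣≡s₂a₂ = sign-unit a₂
    in (+ x * s₁ , - (+ y * s₂)) , (begin
      a₁ * (+ x * s₁) + a₂ * - (+ y * s₂)        ≡⟨ ring a₁ a₂ s₁ s₂ (+ x) (+ y) ⟩
      + x * (s₁ * a₁) - + y * (s₂ * a₂)          ≡⟨ cong₂ (λ u v → + x * u - + y * v) ∣a₁∣≡s₁a₁ ∣a₂∣≡s₂a₂ ⟨
      + x * + ∣ a₁ ∣ - + y * + ∣ a₂ ∣            ≡⟨ cong₂ _-_ (ℤP.pos-* x ∣ a₁ ∣) (ℤP.pos-* y ∣ a₂ ∣) ⟨
      + (x ℕ.* ∣ a₁ ∣) - + (y ℕ.* ∣ a₂ ∣)        ≡⟨ cong (λ k → + k - + (y ℕ.* ∣ a₂ ∣)) eq ⟨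
      + (1 ℕ.+ y ℕ.* ∣ a₂ ∣) - + (y ℕ.* ∣ a₂ ∣)  ≡⟨ cong (_- + (y ℕ.* ∣ a₂ ∣)) (ℤP.pos-+ 1 (y ℕ.* ∣ a₂ ∣)) ⟩
      1ℤ + + (y ℕ.* ∣ a₂ ∣) - + (y ℕ.* ∣ a₂ ∣)   ≡⟨ ring′ (+ (y ℕ.* ∣ a₂ ∣)) ⟩
      1ℤ                                          ∎)
    where
    open ≡-Reasoning
    ring : ∀ a₁ a₂ s₁ s₂ x y → a₁ * (x * s₁) + a₂ * - (y * s₂) ≡ x * (s₁ * a₁) - y * (s₂ * a₂)
    ring = solve-∀
    ring′ : ∀ t → 1ℤ + t - t ≡ 1ℤ
    ring′ = solve-∀

  bézout : ∀ {a₁ a₂} → Coprime ∣ a₁ ∣ ∣ a₂ ∣ → Σ ℤ² λ e → (a₁ , a₂) · e ≡ 1ℤ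
  bézout {a₁} {a₂} coprime with coprime-Bézout coprime
  ... | Bézout.+- x y eq = bézout-identity a₁ a₂ x y eq
  ... | Bézout.-+ x y eq = let e , a₂a₁·e≡1 = bézout-identity a₂ a₁ y x eq in swap e , trans (·-swap (a₂ , a₁) e) a₂a₁·e≡1

  -- c = ⌈U / h⌉, obtained as -⌊-U / h⌋.
  ceiling : ∀ U (h : ℕ) .{{_ : ℕ.NonZero h}} → Σ ℤ λ c → Σ ℕ λ r → r ℕ.< h × c * + h - U ≡ + r
  ceiling U h = - q , r , n%ℕd<d (- U) h , (begin
    - q * + h - U            ≡⟨ ring q (+ h) U ⟩
    - U - q * + h            ≡⟨ cong (_- q * + h) (a≡a%ℕn+[a/ℕn]*n (- U) h) ⟩
    + r + q * + h - q * + h  ≡⟨ ring′ (+ r) (q * + h) ⟩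
    + r                      ∎)
    where
    open ≡-Reasoning
    q : ℤ
    q = (- U) /ℕ h
    r : ℕ
    r = (- U) %ℕ h
    ring : ∀ q h U → - q * h - U ≡ - U - q * h
    ring = solve-∀
    ring′ : ∀ r t → r + t - t ≡ r
    ring′ = solve-∀

  -- In the basis (e, D) the triangle has vertices (0, 0), (0, M), (h, U); it contains the point (1, ⌈U / h⌉).
  step-point : ∀ (p e D : ℤ²) {M} U (h : ℕ) .{{_ : ℕ.NonZero h}} → 1ℤ ≤ M →
               Σ ℤ λ c → Barycentric (p ⊕ e ⊕ c ⊛ D) p (p ⊕ M ⊛ D) (p ⊕ (+ h ⊛ e ⊕ U ⊛ D))
  step-point p@(p₁ , p₂) e@(e₁ , e₂) D@(D₁ , D₂) {M} U h 1≤M =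
    let c , r , r<h , cH-U≡r = ceiling U h
        H = + h
        Bw = c * H - U
        0≤Bw = subst (0ℤ ≤_) (sym cH-U≡r) (ℤ.+≤+ ℕ.z≤n)
        Bw<H = subst (_< H) (sym cH-U≡r) (ℤ.+<+ r<h)
    in c , barycentric (H * M - M - Bw) Bw M
             (subst (0ℤ ≤_) (sym (split-Aw H M Bw))
               (ℤP.+-mono-≤ (0≤i*j (ℤP.i≤j⇒0≤j-i 1≤M) (ℤP.i≤j⇒0≤j-i 1≤H)) (ℤP.i≤j⇒0≤j-i (ℤP.i<j⇒suc[i]≤j Bw<H))))
             0≤Bw (ℤP.≤-trans (ℤ.+≤+ ℕ.z≤n) 1≤M)
             (subst (0ℤ <_) (sym (Σ-weights H M Bw)) (0<i*j (ℤP.<-≤-trans (ℤ.+<+ ℕ.z<s) 1≤H) (ℤP.<-≤-trans (ℤ.+<+ ℕ.z<s) 1≤M)))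
             (cong₂ _,_ (balance H M c U p₁ e₁ D₁) (balance H M c U p₂ e₂ D₂))
    where
    1≤H : 1ℤ ≤ + h
    1≤H = ℤ.+≤+ (ℕ.>-nonZero⁻¹ h)
    split-Aw : ∀ H M Bw → H * M - M - Bw ≡ (M - 1ℤ) * (H - 1ℤ) + (H - (1ℤ + Bw))
    split-Aw = solve-∀
    Σ-weights : ∀ H M Bw → H * M - M - Bw + Bw + M ≡ H * M
    Σ-weights = solve-∀
    balance : ∀ H M c U p e D →
      (H * M - M - (c * H - U)) * (p - (p + e + c * D)) + (c * H - U) * (p + M * D - (p + e + c * D))
        + M * (p + (H * e + U * D) - (p + e + c * D)) ≡ 0ℤ
    balance = solve-∀

  module _ {a : ℤ²} {a₀} {p q x : Pt n} (ap≡a₀ : a · vec p ≡ a₀) (aq≡a₀ : a · vec q ≡ a₀) (p≢q : p ≢ q)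
           (h : ℕ) .{{_ : ℕ.NonZero h}} (ax≡a₀+h : a · vec x ≡ a₀ + + h) where

    private
      module _ {e} (a·e≡1 : a · e ≡ 1ℤ) where

        split : ∀ v → v ≡ (a · v) ⊛ e ⊕ det e v ⊛ perp a
        split v = begin
          v                                    ≡⟨ 1⊛ v ⟨
          1ℤ ⊛ v                               ≡⟨ cong (_⊛ v) a·e≡1 ⟨
          (a · e) ⊛ v                          ≡⟨ decompose a e v ⟩
          (a · v) ⊛ e ⊕ det e v ⊛ perp a       ∎
          where open ≡-Reasoning

        m U : ℤ
        m = det e (vec q ⊖ vec p)
        U = det e (vec x ⊖ vec p)

        q-p : vec q ⊖ vec p ≡ m ⊛ perp a
        q-p = trans (split (vec q ⊖ vec p))
                (trans (cong (λ k → k ⊛ e ⊕ m ⊛ perp a) (trans (·-⊖ a (vec q) (vec p)) (ℤP.i≡j⇒i-j≡0 (trans aq≡a₀ (sym ap≡a₀)))))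
                       (0⊛⊕ e (m ⊛ perp a)))

        x≡ : vec x ≡ vec p ⊕ (+ h ⊛ e ⊕ U ⊛ perp a)
        x≡ = ⊖≡⇒≡⊕ (vec x) (vec p) (trans (split (vec x ⊖ vec p))
               (cong (λ k → k ⊛ e ⊕ U ⊛ perp a) (trans (·-⊖ a (vec x) (vec p)) (trans (cong₂ _-_ ax≡a₀+h ap≡a₀) (ring a₀ (+ h))))))
          where
          ring : ∀ a₀ h → a₀ + h - a₀ ≡ h
          ring = solve-∀

        along : ∀ D {M} U → a · D ≡ 0ℤ → 1ℤ ≤ M → vec q ≡ vec p ⊕ M ⊛ D → vec x ≡ vec p ⊕ (+ h ⊛ e ⊕ U ⊛ D) →
                Σ ℤ² λ z → a · z ≡ a₀ + 1ℤ × Barycentric z (vec p) (vec q) (vec x)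
        along D U aD≡0 1≤M q≡ x≡ =
          let c , bary = step-point (vec p) e D U h 1≤M in
          vec p ⊕ e ⊕ c ⊛ D , (begin
            a · (vec p ⊕ e ⊕ c ⊛ D)          ≡⟨ ·-⊕⊕⊛ a (vec p) e c D ⟩
            a · vec p + a · e + c * (a · D)  ≡⟨ cong₂ (λ s t → s + t + c * (a · D)) ap≡a₀ a·e≡1 ⟩
            a₀ + 1ℤ + c * (a · D)            ≡⟨ cong (λ t → a₀ + 1ℤ + c * t) aD≡0 ⟩
            a₀ + 1ℤ + c * 0ℤ                 ≡⟨ cong (λ t → a₀ + 1ℤ + t) (ℤP.*-zeroʳ c) ⟩
            a₀ + 1ℤ + 0ℤ                     ≡⟨ ℤP.+-identityʳ (a₀ + 1ℤ) ⟩
            a₀ + 1ℤ                          ∎) , subst₂ (Barycentric (vec p ⊕ e ⊕ c ⊛ D) (vec p)) (sym q≡) (sym x≡) bary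
          where open ≡-Reasoning

        by-sign : Tri (0ℤ < m) (0ℤ ≡ m) (m < 0ℤ) → Σ ℤ² λ z → a · z ≡ a₀ + 1ℤ × Barycentric z (vec p) (vec q) (vec x)
        by-sign (tri< 0<m _ _) = along (perp a) U (·-perp-self a) (ℤP.i<j⇒suc[i]≤j 0<m) (⊖≡⇒≡⊕ (vec q) (vec p) q-p) x≡
        by-sign (tri> _ _ m<0) = along (⊝ perp a) (- U) (·-⊝-perp-self a) (ℤP.i<j⇒suc[i]≤j (ℤP.neg-mono-< m<0))
          (trans (⊖≡⇒≡⊕ (vec q) (vec p) q-p) (cong (vec p ⊕_) (⊛-⊝ m (perp a))))
          (trans x≡ (cong (λ v → vec p ⊕ (+ h ⊛ e ⊕ v)) (⊛-⊝ U (perp a))))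
        by-sign (tri≈ _ 0≡m _) = contradiction (sym (⊖≡0²⇒≡ (trans q-p (cong (_⊛ perp a) (sym 0≡m))))) p≢q

    lattice-point-above : Coprime ∣ proj₁ a ∣ ∣ proj₂ a ∣ → Σ ℤ² λ z → a · z ≡ a₀ + 1ℤ × Barycentric z (vec p) (vec q) (vec x)
    lattice-point-above coprime =
      let e , a·e≡1 = bézout {proj₁ a} {proj₂ a} coprime in by-sign a·e≡1 (ℤP.<-cmp 0ℤ (det e (vec q ⊖ vec p)))

module EssentialPoints where

  open Signs
  open Plane
  open Grid
  open Hull
  open Separation
  open Convexity
  open Edges
  open LatticePoints
  open import Data.Nat as ℕ using (ℕ)
  open import Data.Integer as ℤ using (ℤ; +_; 0ℤ; 1ℤ; _+_; _*_; _-_; -_; _≤_; _<_)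
  import Data.Integer.Properties as ℤP
  open import Data.Integer.Tactic.RingSolver using (solve-∀)
  open import Data.Bool as Bool using (true; not)
  import Data.Bool.Properties as BoolP
  open import Data.Product using (Σ; _×_; _,_; proj₁; proj₂)
  open import Data.Sum using (_⊎_; inj₁; inj₂)
  open import Relation.Nullary using (¬_; Dec; yes; no)
  open import Relation.Unary using (Decidable)
  open import Function using (_∘_)
  open import Data.Nat.Coprimality using (Coprime; 0-coprimeTo-m⇒m≡1)
  open import Relation.Nullary.Negation using (contradiction)
  open import Relation.Binary.Definitions using (Tri; tri<; tri≈; tri>)
  open import Relation.Binary.PropositionalEquality

  private variable n : ℕ

  essential⇒vertex : ∀ {f : BoolFun n} {x} → Essential n f x → M₁ f x → IsVertex n f x
  essential⇒vertex {f = f} {x} (g , T-g , gx≢fx , agree) fx = fx , λ x∈hull →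
    gx≢fx (trans (InT⇒latticeConvex T-g x (InConv-mono (λ {p} (fp , p≢x) → trans (agree p p≢x) fp) x∈hull)) (sym fx))

  M₀⇒∉P : ∀ {f : BoolFun n} {x} → InT n f → M₀ f x → ¬ InP n f x
  M₀⇒∉P T-f fx x∈P = contradiction (trans (sym (InT⇒latticeConvex T-f _ x∈P)) fx) λ ()

  vertex⇒essential : ∀ {f : BoolFun n} {x} → InT n f → IsVertex n f x → Essential n f x
  vertex⇒essential {n} {f} {x} T-f (fx , x∉hull) = InT-flip-at⇒essential (latticeConvex⇒InT convex)
    where
    flipped⊆ : ∀ {p} → M₁ (flip-at f x) p → M₁ f p × p ≢ x
    flipped⊆ {p} gp = by-cases (p ≟ₚ x)
      where
      by-cases : Dec (p ≡ x) → M₁ f p × p ≢ x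
      by-cases (yes refl) = contradiction (trans (sym gp) (trans (flip-at-here f x) (cong not fx))) λ ()
      by-cases (no p≢x)   = trans (sym (flip-at-elsewhere f p≢x)) gp , p≢x
    convex : LatticeConvex n (flip-at f x)
    convex y y∈hull = by-cases (y ≟ₚ x)
      where
      by-cases : Dec (y ≡ x) → flip-at f x y ≡ true
      by-cases (yes refl) = contradiction (InConv-mono flipped⊆ y∈hull) x∉hull
      by-cases (no y≢x)   = trans (flip-at-elsewhere f y≢x) (InT⇒latticeConvex T-f y (InConv-mono (λ gp → proj₁ (flipped⊆ gp)) y∈hull))

  essential⇒InP′ : ∀ {f : BoolFun n} {x} → Essential n f x → M₀ f x → InP' n f x
  essential⇒InP′ {n} {f} {x} (g , T-g , gx≢fx , agree) fx a₁ a₂ a₀ (coprime , below , p , q , p≢q , fp , fq , ap≡a₀ , aq≡a₀) =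
    ℤP.≮⇒≥ λ a₀+1<ax → let k , ax≡ = gap a₀+1<ax in no-lattice-point a₀+1<ax (lattice-point-above {a = a} ap≡a₀ aq≡a₀ p≢q (2 ℕ.+ k) ax≡ coprime)
    where
    a : ℤ²
    a = a₁ , a₂
    gap : a₀ + 1ℤ < a · vec x → Σ ℕ λ k → a · vec x ≡ a₀ + + (2 ℕ.+ k)
    gap a₀+1<ax = ℤ.∣ d ∣ , (begin
      a · vec x                       ≡⟨ ring (a · vec x) a₀ ⟩
      a₀ + (+ 2 + d)                  ≡⟨ cong (λ t → a₀ + (+ 2 + t)) (ℤP.0≤i⇒+∣i∣≡i 0≤d) ⟨
      a₀ + (+ 2 + + ℤ.∣ d ∣)          ≡⟨ cong (λ t → a₀ + t) (ℤP.pos-+ 2 ℤ.∣ d ∣) ⟨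
      a₀ + + (2 ℕ.+ ℤ.∣ d ∣)          ∎)
      where
      open ≡-Reasoning
      d : ℤ
      d = a · vec x - (1ℤ + (a₀ + 1ℤ))
      0≤d : 0ℤ ≤ d
      0≤d = ℤP.i≤j⇒0≤j-i (ℤP.i<j⇒suc[i]≤j a₀+1<ax)
      ring : ∀ t a₀ → t ≡ a₀ + (+ 2 + (t - (1ℤ + (a₀ + 1ℤ))))
      ring = solve-∀
    M₁⇒≢x : ∀ {s} → M₁ f s → s ≢ x
    M₁⇒≢x fs refl = contradiction (trans (sym fs) fx) λ ()
    g⊇f : ∀ {s} → M₁ f s → M₁ g s
    g⊇f fs = trans (agree _ (M₁⇒≢x fs)) fs
    gx : M₁ g x
    gx = BoolP.¬-not λ gx≡false → gx≢fx (trans gx≡false (sym fx))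
    no-lattice-point : a₀ + 1ℤ < a · vec x → ¬ (Σ ℤ² λ z → a · z ≡ a₀ + 1ℤ × Barycentric z (vec p) (vec q) (vec x))
    no-lattice-point a₀+1<ax (z , az≡a₀+1 , bary) =
      let Z , vecZ≡z = barycentric-on-grid bary
          aZ≡a₀+1 = trans (cong (a ·_) vecZ≡z) az≡a₀+1
          gZ = InT⇒latticeConvex T-g Z (barycentric⇒InHull (g⊇f fp) (g⊇f fq) gx (subst (λ z → Barycentric z _ _ _) (sym vecZ≡z) bary))
          Z≢x = λ Z≡x → ℤP.<-irrefl (trans (sym aZ≡a₀+1) (cong (λ s → a · vec s) Z≡x)) a₀+1<ax
          a₀+1≤a₀ = subst (_≤ a₀) aZ≡a₀+1 (below Z (trans (sym (agree Z Z≢x)) gZ))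
      in ℤP.<-irrefl refl (ℤP.suc[i]≤j⇒i<j (subst (_≤ a₀) (ℤP.+-comm a₀ 1ℤ) a₀+1≤a₀))

  module _ {S : Pt n → Set} {a : ℤ²} {a₀} {x y : Pt n} (below : ∀ {s} → S s → a · vec s ≤ a₀)
           (ax≡ : a · vec x ≡ a₀ + 1ℤ) (ay≡ : a · vec y ≡ a₀ + 1ℤ) where

    private
      -- Rotate the line a·z = a₀ + 1 slightly around x: add K a to the direction τ, with K large enough that
      -- S stays below.
      tilted-within : ∀ τ M → (∀ s → τ · vec s ≤ M) → τ · vec x < τ · vec y → Cut (λ s → S s ⊎ s ≡ x) y
      tilted-within τ M τ≤M τx<τy = record
        { normal = K ⊛ a ⊕ τ
        ; bound  = K * (a₀ + 1ℤ) + τ · vec x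
        ; keeps  = keeps
        ; cuts   = subst (K * (a₀ + 1ℤ) + τ · vec x <_)
                     (sym (trans (·-⊛⊕ K a τ (vec y)) (cong (λ t → K * t + τ · vec y) ay≡)))
                     (ℤP.+-monoʳ-< (K * (a₀ + 1ℤ)) τx<τy)
        }
        where
        K : ℤ
        K = M - τ · vec x
        0≤K : 0ℤ ≤ K
        0≤K = ℤP.i≤j⇒0≤j-i (τ≤M x)
        keeps : ∀ {s} → S s ⊎ s ≡ x → (K ⊛ a ⊕ τ) · vec s ≤ K * (a₀ + 1ℤ) + τ · vec x
        keeps {s} (inj₁ Ss) = begin
          (K ⊛ a ⊕ τ) · vec s          ≡⟨ ·-⊛⊕ K a τ (vec s) ⟩
          K * (a · vec s) + τ · vec s  ≤⟨ ℤP.+-mono-≤ (ℤP.*-monoˡ-≤-nonNeg K {{ℤ.nonNegative 0≤K}} (below Ss)) (τ≤M s) ⟩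
          K * a₀ + M                   ≡⟨ ring M (τ · vec x) a₀ ⟩
          K * (a₀ + 1ℤ) + τ · vec x    ∎
          where
          open ℤP.≤-Reasoning
          ring : ∀ M t a₀ → (M - t) * a₀ + M ≡ (M - t) * (a₀ + 1ℤ) + t
          ring = solve-∀
        keeps (inj₂ refl) = ℤP.≤-reflexive (trans (·-⊛⊕ K a τ (vec x)) (cong (λ t → K * t + τ · vec x) ax≡))

      tilted : ∀ τ → τ · vec x < τ · vec y → Cut (λ s → S s ⊎ s ≡ x) y
      tilted τ = let M , τ≤M = bounded (λ (s : Pt n) → τ · vec s) in tilted-within τ M τ≤M

    tilt : a ≢ 0² → x ≢ y → Cut (λ s → S s ⊎ s ≡ x) y
    tilt a≢0 x≢y = by-side (ℤP.<-cmp (perp a · vec x) (perp a · vec y))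
      where
      by-side : Tri (perp a · vec x < perp a · vec y) (perp a · vec x ≡ perp a · vec y) (perp a · vec y < perp a · vec x) →
                Cut (λ s → S s ⊎ s ≡ x) y
      by-side (tri< τx<τy _ _) = tilted (perp a) τx<τy
      by-side (tri> _ _ τy<τx) = tilted (⊝ perp a) (subst₂ _<_ (sym (·-⊝ (perp a) (vec x))) (sym (·-⊝ (perp a) (vec y))) (ℤP.neg-mono-< τy<τx))
      by-side (tri≈ _ τx≡τy _) = contradiction (sym (⊖≡0²⇒≡ (·≡0∧det≡0⇒≡0² a≢0
        (trans (·-⊖ a (vec y) (vec x)) (ℤP.i≡j⇒i-j≡0 (trans ay≡ (sym ax≡))))
        (trans (·-⊖ (perp a) (vec y) (vec x)) (ℤP.i≡j⇒i-j≡0 (sym τx≡τy)))))) x≢y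

  module _ {f : BoolFun n} (T-f : InT n f) (area : PositiveArea n f) {x : Pt n} (x∈P′ : InP' n f x) where

    private
      M₁? : Decidable (M₁ f)
      M₁? s = f s Bool.≟ true

      cut-beyond : ∀ {y} → M₀ f y → y ≢ x → Cut (λ s → M₁ f s ⊎ s ≡ x) y
      cut-beyond {y} fy y≢x = from-separation (separate M₁? y∉M₁)
        where
        y∉M₁ : ∀ {s} → M₁ f s → s ≢ y
        y∉M₁ fs refl = contradiction (trans (sym fs) fy) λ ()
        from-edge : EdgeBeyond n f y → Cut (λ s → M₁ f s ⊎ s ≡ x) y
        from-edge (a₁ , a₂ , a₀ , edge@(coprime , below , _) , a₀<ay) =
          by-position (a · vec x ℤP.≤? a₀) (a · vec y ℤP.≤? a₀ + 1ℤ)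
          where
          a : ℤ²
          a = a₁ , a₂
          ax≤a₀+1 : a · vec x ≤ a₀ + 1ℤ
          ax≤a₀+1 = x∈P′ a₁ a₂ a₀ edge
          a≢0² : a ≢ 0²
          a≢0² a≡0 = contradiction (0-coprimeTo-m⇒m≡1 (subst₂ Coprime (cong (ℤ.∣_∣ ∘ proj₁) a≡0) (cong (ℤ.∣_∣ ∘ proj₂) a≡0) coprime)) λ ()
          <⇒+1≤ : ∀ {t} → a₀ < t → a₀ + 1ℤ ≤ t
          <⇒+1≤ {t} a₀<t = subst (_≤ t) (ℤP.+-comm 1ℤ a₀) (ℤP.i<j⇒suc[i]≤j a₀<t)
          keeps-below : ∀ {b} → a₀ ≤ b → a · vec x ≤ b → ∀ {s} → M₁ f s ⊎ s ≡ x → a · vec s ≤ b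
          keeps-below a₀≤b ax≤b (inj₁ fs)   = ℤP.≤-trans (below _ fs) a₀≤b
          keeps-below a₀≤b ax≤b (inj₂ refl) = ax≤b
          by-position : Dec (a · vec x ≤ a₀) → Dec (a · vec y ≤ a₀ + 1ℤ) → Cut (λ s → M₁ f s ⊎ s ≡ x) y
          by-position (yes ax≤a₀) _ =
            record { normal = a ; bound = a₀ ; keeps = keeps-below ℤP.≤-refl ax≤a₀ ; cuts = a₀<ay }
          by-position (no _) (no ay≰a₀+1) =
            record { normal = a ; bound = a₀ + 1ℤ ; keeps = keeps-below (ℤP.i≤i+j a₀ 1ℤ) ax≤a₀+1 ; cuts = ℤP.≰⇒> ay≰a₀+1 }
          by-position (no ax≰a₀) (yes ay≤a₀+1) =
            tilt (below _) (ℤP.≤-antisym ax≤a₀+1 (<⇒+1≤ (ℤP.≰⇒> ax≰a₀))) (ℤP.≤-antisym ay≤a₀+1 (<⇒+1≤ a₀<ay)) a≢0² (y≢x ∘ sym)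
        from-separation : InP n f y ⊎ Separated (M₁ f) y → Cut (λ s → M₁ f s ⊎ s ≡ x) y
        from-separation (inj₁ y∈P) = contradiction (trans (sym (InT⇒latticeConvex T-f y y∈P)) fy) λ ()
        from-separation (inj₂ (c , c-separates)) = from-edge (edge-beyond area {c = c} c-separates)

    ΔP⇒essential : M₀ f x → Essential n f x
    ΔP⇒essential fx = InT-flip-at⇒essential (cuts⇒InT cut)
      where
      cut : ∀ y → M₀ (flip-at f x) y → Cut (M₁ (flip-at f x)) y
      cut y gy = by-cases (y ≟ₚ x)
        where
        by-cases : Dec (y ≡ x) → Cut (M₁ (flip-at f x)) y
        by-cases (yes refl) = contradiction (trans (sym (trans (flip-at-here f x) (cong not fx))) gy) λ ()
        by-cases (no y≢x)   = Cut-⊆ (M₁-flip-at⊆ f x) (cut-beyond (trans (sym (flip-at-elsewhere f y≢x)) gy) y≢x)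

open EssentialPoints
open import Data.Bool as Bool using (true)
import Data.Bool.Properties as BoolP
open import Data.Sum using (inj₁; inj₂)
open import Data.Product using (_,_)
open import Function.Bundles using (mk⇔)
open import Relation.Nullary using (yes; no)

corollary3 : (n : ℕ) → n ≥ 2 → (f : BoolFun n) → InT n f → PositiveArea n f →
    (x : Pt n) → Essential n f x ⇔ ((InΔP n f x × M₀ f x) ⊎ IsVertex n f x)
corollary3 n _ f T-f area x = mk⇔ to from
  where
  -- The hypothesis n ≥ 2 is unused; for n < 2 no function has positive area anyway.
  to : Essential n f x → (InΔP n f x × M₀ f x) ⊎ IsVertex n f x
  to essential with f x Bool.≟ true
  ... | yes fx   = inj₂ (essential⇒vertex essential fx)
  ... | no fx≢1 = let fx = BoolP.¬-not fx≢1 in inj₁ ((essential⇒InP′ essential fx , M₀⇒∉P T-f fx) , fx)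
  from : (InΔP n f x × M₀ f x) ⊎ IsVertex n f x → Essential n f x
  from (inj₁ ((x∈P′ , _) , fx)) = ΔP⇒essential T-f area x∈P′ fx
  from (inj₂ vertex)             = vertex⇒essential T-f vertex
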